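{- Let $X$ and $X'$ be $B$-terms. Then \[ l(X'\,X)=l(X')-1+\max\{l(X)-a(X'),\,0\}, \] \[ a(X'\,X)=a(X)+a(N_1(X'))+\max\{a(X')-l(X),\,0\}, \] and, with $m=\min\{l(X),a(X')\}$, \[ N_1(X'\,X)=\begin{cases} N_1(X)[N_2(X')/x_2,\dots,N_m(X')/x_m] & \text{if } N_1(X') \text{ is a single variable},\\ N_1(N_1(X')) & \text{otherwise,}\end{cases} \] the last equality being an equality of binary trees (i.e. up to the names of the variables).
   Context: $B=\lambda f.\lambda g.\lambda x.\, f\,(g\,x)$; $B$-terms are combinatory terms built from $B$ by application. Every $B$-term $X$ has a $\beta\eta$-normal form of the shape $\lambda x_1.\cdots\lambda x_n.\,x_1\,e_1\cdots e_k$ where $e_1,\dots,e_k$ are built from the variables $x_2,\dots,x_n$ by application only. For such $X$ define $l(X)=n$ (the number of variables, i.e. the number of leaves of the associated binary tree obtained by replacing variables by leaves and applications by binary nodes), $a(X)=k$, and $N_i(X)=e_i$ for $1\le i\le k$. For an applicative term $e=y\,g_1\cdots g_r$ with $y$ a variable, set $a(e)=r$ and $N_1(e)=g_1$ (when $r\ge1$). $e[s_2/x_2,\dots,s_m/x_m]$ denotes simultaneous substitution of $s_i$ for $x_i$ in $e$, where the $x_i$ are the bound variables of the normal form of $X$ and the $s_i=N_i(X')$ are the argument terms of the normal form of $X'$. -}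

module Defs where

open import Data.Nat using (ℕ; zero; suc; _+_; _∸_; _⊓_; _<ᵇ_; _≤ᵇ_)
open import Data.Fin using (Fin; zero; suc; toℕ; opposite)
open import Data.List using (List; []; _∷_; _++_; [_]; length)
open import Data.List.Relation.Unary.All using (All)
open import Data.Maybe using (Maybe; just; nothing; maybe)
import Data.Maybe as Maybe
open import Data.Sum using (_⊎_; inj₁; inj₂)
open import Data.Product using (Σ; _×_)
open import Data.Unit using (⊤)
open import Data.Bool using (Bool; true; false; if_then_else_; _∧_)
open import Relation.Nullary using (¬_)
open import Relation.Binary.PropositionalEquality using (_≡_; _≢_)
open import Relation.Binary.Construct.Closure.Equivalence using (EqClosure)

data Term : ℕ → Set where
  var : ∀ {n} → Fin n → Term n
  ƛ   : ∀ {n} → Term (suc n) → Term n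
  _·_ : ∀ {n} → Term n → Term n → Term n

infixl 7 _·_

ext : ∀ {m n} → (Fin m → Fin n) → Fin (suc m) → Fin (suc n)
ext ρ zero    = zero
ext ρ (suc i) = suc (ρ i)

ren : ∀ {m n} → (Fin m → Fin n) → Term m → Term n
ren ρ (var i) = var (ρ i)
ren ρ (ƛ t)   = ƛ (ren (ext ρ) t)
ren ρ (t · u) = ren ρ t · ren ρ u

exts : ∀ {m n} → (Fin m → Term n) → Fin (suc m) → Term (suc n)
exts σ zero    = var zero
exts σ (suc i) = ren suc (σ i)

sub : ∀ {m n} → (Fin m → Term n) → Term m → Term n
sub σ (var i) = σ i
sub σ (ƛ t)   = ƛ (sub (exts σ) t)
sub σ (t · u) = sub σ t · sub σ u

sub₀ : ∀ {n} → Term n → Fin (suc n) → Term n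
sub₀ u zero    = u
sub₀ u (suc i) = var i

_[_]ₜ : ∀ {n} → Term (suc n) → Term n → Term n
t [ u ]ₜ = sub (sub₀ u) t

data _⟶_ {n : ℕ} : Term n → Term n → Set where
  β   : ∀ {t : Term (suc n)} {u} → (ƛ t · u) ⟶ (t [ u ]ₜ)
  η   : ∀ {t' : Term (suc n)} {t : Term n} → t' ≡ ren suc t → ƛ (t' · var zero) ⟶ t
  ξƛ  : ∀ {t t' : Term (suc n)} → t ⟶ t' → ƛ t ⟶ ƛ t'
  ξl  : ∀ {t t' u : Term n} → t ⟶ t' → (t · u) ⟶ (t' · u)
  ξr  : ∀ {t u u' : Term n} → u ⟶ u' → (t · u) ⟶ (t · u')

_≈βη_ : ∀ {n} → Term n → Term n → Set
_≈βη_ = EqClosure _⟶_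

Normal : ∀ {n} → Term n → Set
Normal t = ∀ {t'} → ¬ (t ⟶ t')

-- B-terms and their λ-interpretation; B = λf.λg.λx. f (g x)

data BTerm : Set where
  𝐁   : BTerm
  _∙_ : BTerm → BTerm → BTerm

infixl 7 _∙_

⟦_⟧ : BTerm → Term 0
⟦ 𝐁 ⟧     = ƛ (ƛ (ƛ (var (suc (suc zero)) · (var (suc zero) · var zero))))
⟦ X ∙ Y ⟧ = ⟦ X ⟧ · ⟦ Y ⟧

data Ap (V : Set) : Set where
  v   : V → Ap V
  _⊛_ : Ap V → Ap V → Ap V

infixl 7 _⊛_

headVar : ∀ {V} → Ap V → V
headVar (v y)   = y
headVar (f ⊛ g) = headVar f

args : ∀ {V} → Ap V → List (Ap V)
args (v y)   = []
args (f ⊛ g) = args f ++ [ g ]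

a : ∀ {V} → Ap V → ℕ
a e = length (args e)

-- i-th argument, counting from 0 (so N_i = nthArg (i - 1))
nth : ∀ {A : Set} → ℕ → List A → Maybe A
nth i       []       = nothing
nth zero    (x ∷ xs) = just x
nth (suc i) (x ∷ xs) = nth i xs

N₁ : ∀ {V} → Ap V → Maybe (Ap V)
N₁ e = nth 0 (args e)

vars : ∀ {V} → Ap V → List V
vars (v y)   = y ∷ []
vars (f ⊛ g) = vars f ++ vars g

isVar : ∀ {V} → Ap V → Bool
isVar (v _)   = true
isVar (_ ⊛ _) = false

substAp : ∀ {V W} → (V → Ap W) → Ap V → Ap W
substAp σ (v y)   = σ y
substAp σ (f ⊛ g) = substAp σ f ⊛ substAp σ g

mapAp : ∀ {V W} → (V → W) → Ap V → Ap W
mapAp ρ = substAp (λ y → v (ρ y))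

data Tree : Set where
  leaf : Tree
  node : Tree → Tree → Tree

shape : ∀ {V} → Ap V → Tree
shape (v _)   = leaf
shape (f ⊛ g) = node (shape f) (shape g)

-- Normal forms  λx₁⋯λxₙ. x₁ e₁ ⋯ e_k.
-- The body  x₁ e₁ ⋯ e_k  is an  Ap (Fin n)  where variable x_i is  i-1 : Fin n.

embed : ∀ {n} → Ap (Fin n) → Term n
embed (v y)   = var (opposite y)      -- x₁ is bound by the outermost λ
embed (f ⊛ g) = embed f · embed g

lams : ∀ n → Term n → Term 0
lams zero    t = t
lams (suc n) t = lams n (ƛ t)

record IsNF (t : Term 0) (n : ℕ) (body : Ap (Fin n)) : Set where
  field
    conv     : t ≈βη lams n (embed body)
    normal   : Normal (lams n (embed body))
    headX₁   : toℕ (headVar body) ≡ 0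
    argsNoX₁ : All (λ g → All (λ y → toℕ y ≢ 0) (vars g)) (args body)

-- Data of the lemma. For a normal form with body e:
--   l = n,  a(X) = a e,  N_i(X) = nth (i-1) (args e).

-- a(N₁(X')) ; (N₁(X') always exists for B-terms; default 0 otherwise)
aN₁ : ∀ {V} → Ap V → ℕ
aN₁ e = maybe a 0 (N₁ e)

-- the substitution  x_i ↦ N_i(X')  for 2 ≤ i ≤ m, all other x_i left as variables
-- (variables of the result: inj₁ = those of X, inj₂ = those of X')
σX : ∀ {n n'} → ℕ → Ap (Fin n') → Fin n → Ap (Fin n ⊎ Fin n')
σX {n} {n'} m e' j =
  if (1 ≤ᵇ toℕ j) ∧ (toℕ j <ᵇ m)
  then maybe (mapAp inj₂) (v (inj₁ j)) (nth (toℕ j) (args e'))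
  else v (inj₁ j)

-- the claim about N₁(X'X), as an equality of binary trees;
-- it is only asserted when its right-hand side is defined
N₁-claim : ∀ {p n n'} → Ap (Fin p) → Ap (Fin n) → Ap (Fin n') → Set
N₁-claim {p} {n} {n'} q e e' with N₁ e'
... | nothing = ⊤
... | just (f ⊛ g) = Maybe.map shape (N₁ q) ≡ Maybe.map shape (N₁ (f ⊛ g))
... | just (v _) with N₁ e
...   | nothing = ⊤
...   | just e₁ = Maybe.map shape (N₁ q) ≡ just (shape (substAp (σX (n ⊓ a e') e') e₁))

-- A B-term X has a βη-normal form λx₁⋯λxₙ. x₁ e₁ ⋯ e_k whose body is determined by a binary
-- tree: the leaves, numbered from left to right, become x₁, …, xₙ.  These trees are computed
-- compositionally: the tree of X'X is obtained from that of X by substituting the argument trees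
-- of X', in order, for its leaves, and then applying the result to the argument trees of X' that
-- are left over; explicit β-reductions after an η-expansion justify this.  Parallel β-reduction
-- and η-reduction are confluent and commute, so βη-normal forms are unique and the given normal
-- forms of X and X' are these canonical ones.  The three formulas are then read off the grafting:
-- counting leaves and arguments gives l and a, and N₁(X'X) is the first argument of the first
-- argument tree of X' when that tree is not a leaf, and otherwise the first argument of X with
-- the remaining arguments of X' grafted in.

module Submission where

open import Defs
open import Data.Nat using (ℕ; zero; suc; _+_; _∸_; pred; _⊓_; _≤_; _<_; z≤n; s≤s; _<ᵇ_; _≤ᵇ_)
open import Data.Nat.Properties
open import Data.Fin using (Fin; zero; suc; toℕ; opposite)
open import Data.Fin.Properties using (toℕ-inject₁; toℕ-fromℕ; opposite-involutive)
open import Data.List using (List; []; _∷_; _++_; [_]; length; map; drop; take)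
open import Data.List.Properties
  using (++-assoc; ++-identityʳ; map-++; length-map; length-++; length-drop; drop-map; drop-drop; drop-[];
         take++drop≡id; length-take; drop-all; map-cong; map-∘)
open import Data.List.Relation.Unary.All using (All; []; _∷_)
import Data.List.Relation.Unary.All as All
open import Data.List.Relation.Unary.All.Properties using (map⁺; ++⁺)
open import Data.Maybe using (just; maybe; maybe′)
import Data.Maybe as Maybe
open import Data.Bool using (true; false) renaming (T to True)
open import Data.Sum using (_⊎_; inj₁; inj₂)
open import Data.Product using (Σ; ∃-syntax; _×_; _,_; proj₁; proj₂)
open import Data.Empty using (⊥-elim)
open import Relation.Nullary using (yes; no)
open import Relation.Binary.PropositionalEquality hiding ([_])
open import Relation.Binary.Rewriting using (Confluent; conf⇒unf)
open import Relation.Binary.Construct.Closure.ReflexiveTransitive using (Star; ε; _◅_; _◅◅_; gmap; return)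
open import Relation.Binary.Construct.Closure.Symmetric using (fwd; bwd)
import Relation.Binary.Construct.Closure.Equivalence as EqClosure
import Relation.Binary.Construct.Closure.Reflexive as Refl

-- Substitution

ext-cong : ∀ {m n} {ρ ρ' : Fin m → Fin n} → (∀ i → ρ i ≡ ρ' i) → ∀ i → ext ρ i ≡ ext ρ' i
ext-cong h zero    = refl
ext-cong h (suc i) = cong suc (h i)

ren-cong : ∀ {m n} {ρ ρ' : Fin m → Fin n} → (∀ i → ρ i ≡ ρ' i) → ∀ t → ren ρ t ≡ ren ρ' t
ren-cong h (var i) = cong var (h i)
ren-cong h (ƛ t)   = cong ƛ (ren-cong (ext-cong h) t)
ren-cong h (t · u) = cong₂ _·_ (ren-cong h t) (ren-cong h u)

ren-id : ∀ {m} {ρ : Fin m → Fin m} → (∀ i → ρ i ≡ i) → ∀ t → ren ρ t ≡ t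
ren-id h (var i) = cong var (h i)
ren-id h (ƛ t)   = cong ƛ (ren-id (λ { zero → refl ; (suc i) → cong suc (h i) }) t)
ren-id h (t · u) = cong₂ _·_ (ren-id h t) (ren-id h u)

ren-ren : ∀ {l m n} (ρ : Fin l → Fin m) (ρ' : Fin m → Fin n) t → ren ρ' (ren ρ t) ≡ ren (λ i → ρ' (ρ i)) t
ren-ren ρ ρ' (var i) = refl
ren-ren ρ ρ' (ƛ t)   = cong ƛ (trans (ren-ren (ext ρ) (ext ρ') t) (ren-cong (λ { zero → refl ; (suc i) → refl }) t))
ren-ren ρ ρ' (t · u) = cong₂ _·_ (ren-ren ρ ρ' t) (ren-ren ρ ρ' u)

exts-cong : ∀ {m n} {σ σ' : Fin m → Term n} → (∀ i → σ i ≡ σ' i) → ∀ i → exts σ i ≡ exts σ' i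
exts-cong h zero    = refl
exts-cong h (suc i) = cong (ren suc) (h i)

sub-cong : ∀ {m n} {σ σ' : Fin m → Term n} → (∀ i → σ i ≡ σ' i) → ∀ t → sub σ t ≡ sub σ' t
sub-cong h (var i) = h i
sub-cong h (ƛ t)   = cong ƛ (sub-cong (exts-cong h) t)
sub-cong h (t · u) = cong₂ _·_ (sub-cong h t) (sub-cong h u)

sub-id : ∀ {m} {σ : Fin m → Term m} → (∀ i → σ i ≡ var i) → ∀ t → sub σ t ≡ t
sub-id h (var i) = h i
sub-id h (ƛ t)   = cong ƛ (sub-id (λ { zero → refl ; (suc i) → cong (ren suc) (h i) }) t)
sub-id h (t · u) = cong₂ _·_ (sub-id h t) (sub-id h u)

ren-sub : ∀ {l m n} (σ : Fin l → Term m) (ρ : Fin m → Fin n) t → ren ρ (sub σ t) ≡ sub (λ i → ren ρ (σ i)) t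
ren-sub σ ρ (var i) = refl
ren-sub σ ρ (ƛ t)   = cong ƛ (trans (ren-sub (exts σ) (ext ρ) t) (sub-cong exts-ren t))
  where
  exts-ren : ∀ i → ren (ext ρ) (exts σ i) ≡ exts (λ i → ren ρ (σ i)) i
  exts-ren zero    = refl
  exts-ren (suc i) = trans (ren-ren suc (ext ρ) (σ i)) (sym (ren-ren ρ suc (σ i)))
ren-sub σ ρ (t · u) = cong₂ _·_ (ren-sub σ ρ t) (ren-sub σ ρ u)

sub-ren : ∀ {l m n} (ρ : Fin l → Fin m) (σ : Fin m → Term n) t → sub σ (ren ρ t) ≡ sub (λ i → σ (ρ i)) t
sub-ren ρ σ (var i) = refl
sub-ren ρ σ (ƛ t)   = cong ƛ (trans (sub-ren (ext ρ) (exts σ) t) (sub-cong (λ { zero → refl ; (suc i) → refl }) t))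
sub-ren ρ σ (t · u) = cong₂ _·_ (sub-ren ρ σ t) (sub-ren ρ σ u)

sub-sub : ∀ {l m n} (σ : Fin l → Term m) (τ : Fin m → Term n) t → sub τ (sub σ t) ≡ sub (λ i → sub τ (σ i)) t
sub-sub σ τ (var i) = refl
sub-sub σ τ (ƛ t)   = cong ƛ (trans (sub-sub (exts σ) (exts τ) t) (sub-cong exts-sub t))
  where
  exts-sub : ∀ i → sub (exts τ) (exts σ i) ≡ exts (λ i → sub τ (σ i)) i
  exts-sub zero    = refl
  exts-sub (suc i) = trans (sub-ren suc (exts τ) (σ i)) (sym (ren-sub τ suc (σ i)))
sub-sub σ τ (t · u) = cong₂ _·_ (sub-sub σ τ t) (sub-sub σ τ u)

ren-as-sub : ∀ {m n} (ρ : Fin m → Fin n) t → ren ρ t ≡ sub (λ i → var (ρ i)) t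
ren-as-sub ρ (var i) = refl
ren-as-sub ρ (ƛ t)   = cong ƛ (trans (ren-as-sub (ext ρ) t) (sub-cong (λ { zero → refl ; (suc i) → refl }) t))
ren-as-sub ρ (t · u) = cong₂ _·_ (ren-as-sub ρ t) (ren-as-sub ρ u)

sub-[]ₜ : ∀ {m n} (σ : Fin m → Term n) t u → sub σ (t [ u ]ₜ) ≡ sub (exts σ) t [ sub σ u ]ₜ
sub-[]ₜ σ t u = trans (sub-sub (sub₀ u) σ t) (sym (trans (sub-sub (exts σ) (sub₀ (sub σ u)) t) (sub-cong exts-sub₀ t)))
  where
  exts-sub₀ : ∀ i → sub (sub₀ (sub σ u)) (exts σ i) ≡ sub σ (sub₀ u i)
  exts-sub₀ zero    = refl
  exts-sub₀ (suc i) = trans (sub-ren suc (sub₀ (sub σ u)) (σ i)) (sub-id (λ _ → refl) (σ i))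

ren-[]ₜ : ∀ {m n} (ρ : Fin m → Fin n) t u → ren ρ (t [ u ]ₜ) ≡ ren (ext ρ) t [ ren ρ u ]ₜ
ren-[]ₜ ρ t u = trans (ren-sub (sub₀ u) ρ t) (sym (trans (sub-ren (ext ρ) (sub₀ (ren ρ u)) t) (sub-cong ext-sub₀ t)))
  where
  ext-sub₀ : ∀ i → sub₀ (ren ρ u) (ext ρ i) ≡ ren ρ (sub₀ u i)
  ext-sub₀ zero    = refl
  ext-sub₀ (suc i) = refl

ren-ext-suc-[var-zero] : ∀ {n} (t : Term (suc n)) → ren (ext suc) t [ var zero ]ₜ ≡ t
ren-ext-suc-[var-zero] t = trans (sub-ren (ext suc) (sub₀ (var zero)) t) (sub-id (λ { zero → refl ; (suc i) → refl }) t)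

ren-suc-[]ₜ : ∀ {n} (t : Term n) u → ren suc t [ u ]ₜ ≡ t
ren-suc-[]ₜ t u = trans (sub-ren suc (sub₀ u) t) (sub-id (λ _ → refl) t)

-- Abstract rewriting

Diamond : {A : Set} → (A → A → Set) → Set
Diamond R = ∀ {a b c} → R a b → R a c → ∃[ d ] R b d × R c d

module _ {A : Set} {R : A → A → Set} (diamond : Diamond R) where

  private
    strip : ∀ {a b c} → R a b → Star R a c → ∃[ d ] Star R b d × R c d
    strip r ε = _ , ε , r
    strip r (r' ◅ rs) with diamond r r'
    ... | _ , r₁ , r₂ with strip r₂ rs
    ...   | d , rs' , r₃ = d , r₁ ◅ rs' , r₃

  diamond⇒confluent : Confluent R
  diamond⇒confluent ε rs = _ , rs , ε
  diamond⇒confluent (r ◅ rs) rs' with strip r rs'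
  ... | _ , rs₁ , r₁ with diamond⇒confluent rs rs₁
  ...   | d , rs₂ , rs₃ = d , rs₂ , r₁ ◅ rs₃

module _ {A : Set} {R : A → A → Set} where

  private
    add-refl : ∀ {a b} → Star R a b → Star (Refl.ReflClosure R) a b
    add-refl = gmap (λ x → x) Refl.[_]

    drop-refl : ∀ {a b} → Star (Refl.ReflClosure R) a b → Star R a b
    drop-refl ε                 = ε
    drop-refl (Refl.refl ◅ rs)  = drop-refl rs
    drop-refl (Refl.[ r ] ◅ rs) = r ◅ drop-refl rs

  refl-diamond⇒confluent : Diamond (Refl.ReflClosure R) → Confluent R
  refl-diamond⇒confluent diamond rs rs' with diamond⇒confluent diamond (add-refl rs) (add-refl rs')
  ... | d , rs₁ , rs₂ = d , drop-refl rs₁ , drop-refl rs₂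

module _ {A : Set} {R S : A → A → Set} where

  CommuteStep : Set
  CommuteStep = ∀ {a b c} → R a b → S a c → ∃[ d ] S b d × Star R c d

  Commute : Set
  Commute = ∀ {a b c} → Star R a b → Star S a c → ∃[ d ] Star S b d × Star R c d

  commuteStep⇒commute : CommuteStep → Commute
  commuteStep⇒commute commute = go
    where
    along : ∀ {a b c} → Star R a b → S a c → ∃[ d ] S b d × Star R c d
    along ε s = _ , s , ε
    along (r ◅ rs) s with commute r s
    ... | _ , s₁ , rs₁ with along rs s₁
    ...   | d , s₂ , rs₂ = d , s₂ , rs₁ ◅◅ rs₂

    go : Commute
    go rs ε = _ , ε , rs
    go rs (s ◅ ss) with along rs s
    ... | _ , s₁ , rs₁ with go rs₁ ss
    ...   | d , ss₁ , rs₂ = d , s₁ ◅ ss₁ , rs₂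

  Either* : A → A → Set
  Either* a b = Star R a b ⊎ Star S a b

  either*-confluent : Confluent R → Confluent S → Commute → Confluent Either*
  either*-confluent confR confS commute = diamond⇒confluent diamond
    where
    diamond : Diamond Either*
    diamond (inj₁ r) (inj₁ r') with confR r r'
    ... | d , r₁ , r₂ = d , inj₁ r₁ , inj₁ r₂
    diamond (inj₂ s) (inj₂ s') with confS s s'
    ... | d , s₁ , s₂ = d , inj₂ s₁ , inj₂ s₂
    diamond (inj₁ r) (inj₂ s) with commute r s
    ... | d , s₁ , r₁ = d , inj₂ s₁ , inj₁ r₁
    diamond (inj₂ s) (inj₁ r) with commute r s
    ... | d , s₁ , r₁ = d , inj₁ r₁ , inj₂ s₁

-- Confluence of βη-reduction

infix 4 _⇉_ _⟶η_ _⟶η*_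

data _⇉_ {n : ℕ} : Term n → Term n → Set where
  ⇉-var : ∀ {i} → var i ⇉ var i
  ⇉-ƛ   : ∀ {t t'} → t ⇉ t' → ƛ t ⇉ ƛ t'
  ⇉-·   : ∀ {t t' u u'} → t ⇉ t' → u ⇉ u' → t · u ⇉ t' · u'
  ⇉-β   : ∀ {t t' u u'} → t ⇉ t' → u ⇉ u' → ƛ t · u ⇉ t' [ u' ]ₜ

⇉-refl : ∀ {n} (t : Term n) → t ⇉ t
⇉-refl (var i) = ⇉-var
⇉-refl (ƛ t)   = ⇉-ƛ (⇉-refl t)
⇉-refl (t · u) = ⇉-· (⇉-refl t) (⇉-refl u)

⇉-ren : ∀ {m n} (ρ : Fin m → Fin n) {t t'} → t ⇉ t' → ren ρ t ⇉ ren ρ t'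
⇉-ren ρ ⇉-var       = ⇉-var
⇉-ren ρ (⇉-ƛ p)     = ⇉-ƛ (⇉-ren (ext ρ) p)
⇉-ren ρ (⇉-· p q)   = ⇉-· (⇉-ren ρ p) (⇉-ren ρ q)
⇉-ren ρ (⇉-β {t' = t'} {u' = u'} p q) =
  subst (_ ⇉_) (sym (ren-[]ₜ ρ t' u')) (⇉-β (⇉-ren (ext ρ) p) (⇉-ren ρ q))

⇉-sub : ∀ {m n} {σ σ' : Fin m → Term n} → (∀ i → σ i ⇉ σ' i) → ∀ {t t'} → t ⇉ t' → sub σ t ⇉ sub σ' t'
⇉-sub h ⇉-var     = h _
⇉-sub h (⇉-ƛ p)   = ⇉-ƛ (⇉-sub (⇉-exts h) p)
  where
  ⇉-exts : ∀ {m n} {σ σ' : Fin m → Term n} → (∀ i → σ i ⇉ σ' i) → ∀ i → exts σ i ⇉ exts σ' i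
  ⇉-exts h zero    = ⇉-var
  ⇉-exts h (suc i) = ⇉-ren suc (h i)
⇉-sub h (⇉-· p q) = ⇉-· (⇉-sub h p) (⇉-sub h q)
⇉-sub {σ' = σ'} h (⇉-β {t' = t'} {u' = u'} p q) =
  subst (_ ⇉_) (sym (sub-[]ₜ σ' t' u')) (⇉-β (⇉-sub ⇉-exts p) (⇉-sub h q))
  where
  ⇉-exts : ∀ i → exts _ i ⇉ exts σ' i
  ⇉-exts zero    = ⇉-var
  ⇉-exts (suc i) = ⇉-ren suc (h i)

⇉-[]ₜ : ∀ {n} {t t' : Term (suc n)} {u u'} → t ⇉ t' → u ⇉ u' → t [ u ]ₜ ⇉ t' [ u' ]ₜ
⇉-[]ₜ {u = u} {u'} p q = ⇉-sub ⇉-sub₀ p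
  where
  ⇉-sub₀ : ∀ i → sub₀ u i ⇉ sub₀ u' i
  ⇉-sub₀ zero    = q
  ⇉-sub₀ (suc i) = ⇉-var

complete-development : ∀ {n} → Term n → Term n
complete-development (var i)           = var i
complete-development (ƛ t)             = ƛ (complete-development t)
complete-development (var i · u)       = var i · complete-development u
complete-development (ƛ t · u)         = complete-development t [ complete-development u ]ₜ
complete-development ((t₁ · t₂) · u)   = complete-development (t₁ · t₂) · complete-development u

⇉-complete-development : ∀ {n} {t s : Term n} → t ⇉ s → s ⇉ complete-development t
⇉-complete-development ⇉-var                       = ⇉-var
⇉-complete-development (⇉-ƛ p)                     = ⇉-ƛ (⇉-complete-development p)
⇉-complete-development (⇉-· {t = var i} p q)       = ⇉-· (⇉-complete-development p) (⇉-complete-development q)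
⇉-complete-development (⇉-· {t = ƛ t} (⇉-ƛ p) q)   = ⇉-β (⇉-complete-development p) (⇉-complete-development q)
⇉-complete-development (⇉-· {t = t₁ · t₂} p q)     = ⇉-· (⇉-complete-development p) (⇉-complete-development q)
⇉-complete-development (⇉-β p q)                   = ⇉-[]ₜ (⇉-complete-development p) (⇉-complete-development q)

⇉-diamond : ∀ {n} → Diamond (_⇉_ {n})
⇉-diamond {a = t} p q = complete-development t , ⇉-complete-development p , ⇉-complete-development q

data _⟶η_ {n : ℕ} : Term n → Term n → Set where
  η-step : ∀ {t' : Term (suc n)} {t : Term n} → t' ≡ ren suc t → ƛ (t' · var zero) ⟶η t
  η-ƛ    : ∀ {t t'} → t ⟶η t' → ƛ t ⟶η ƛ t'
  η-·ˡ   : ∀ {t t' u} → t ⟶η t' → t · u ⟶η t' · u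
  η-·ʳ   : ∀ {t u u'} → u ⟶η u' → t · u ⟶η t · u'

_⟶η*_ : ∀ {n} → Term n → Term n → Set
_⟶η*_ = Star _⟶η_

η-ren : ∀ {m n} (ρ : Fin m → Fin n) {t t'} → t ⟶η t' → ren ρ t ⟶η ren ρ t'
η-ren ρ (η-step {t = t} refl) = η-step (trans (ren-ren suc (ext ρ) t) (sym (ren-ren ρ suc t)))
η-ren ρ (η-ƛ s)  = η-ƛ (η-ren (ext ρ) s)
η-ren ρ (η-·ˡ s) = η-·ˡ (η-ren ρ s)
η-ren ρ (η-·ʳ s) = η-·ʳ (η-ren ρ s)

η-sub : ∀ {m n} (σ : Fin m → Term n) {t t'} → t ⟶η t' → sub σ t ⟶η sub σ t'
η-sub σ (η-step {t = t} refl) = η-step (trans (sub-ren suc (exts σ) t) (sym (ren-sub σ suc t)))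
η-sub σ (η-ƛ s)  = η-ƛ (η-sub (exts σ) s)
η-sub σ (η-·ˡ s) = η-·ˡ (η-sub σ s)
η-sub σ (η-·ʳ s) = η-·ʳ (η-sub σ s)

η*-· : ∀ {n} {t t' u u' : Term n} → t ⟶η* t' → u ⟶η* u' → t · u ⟶η* t' · u'
η*-· {t' = t'} {u = u} p q = gmap (_· u) η-·ˡ p ◅◅ gmap (t' ·_) η-·ʳ q

η*-sub-pointwise : ∀ {m n} {σ σ' : Fin m → Term n} → (∀ i → σ i ⟶η* σ' i) → ∀ t → sub σ t ⟶η* sub σ' t
η*-sub-pointwise h (var i) = h i
η*-sub-pointwise {σ = σ} {σ'} h (ƛ t) = gmap ƛ η-ƛ (η*-sub-pointwise η*-exts t)
  where
  η*-exts : ∀ i → exts σ i ⟶η* exts σ' i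
  η*-exts zero    = ε
  η*-exts (suc i) = gmap (ren suc) (η-ren suc) (h i)
η*-sub-pointwise h (t · u) = η*-· (η*-sub-pointwise h t) (η*-sub-pointwise h u)

ren-pullback : ∀ {a b c d} (f : Fin a → Fin c) (g : Fin b → Fin c) (h : Fin d → Fin a) (k : Fin d → Fin b) →
  (∀ x y → f x ≡ g y → ∃[ z ] x ≡ h z × y ≡ k z) →
  ∀ t s → ren f t ≡ ren g s → ∃[ u ] t ≡ ren h u × s ≡ ren k u
ren-pullback f g h k P (var x) (var y) e with P x y (cong (λ { (var z) → z ; _ → f x }) e)
... | z , refl , refl = var z , refl , refl
ren-pullback f g h k P (ƛ t) (ƛ s) e
  with ren-pullback (ext f) (ext g) (ext h) (ext k) P-ext t s (cong (λ { (ƛ z) → z ; _ → ren (ext f) t }) e)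
  where
  P-ext : ∀ x y → ext f x ≡ ext g y → ∃[ z ] x ≡ ext h z × y ≡ ext k z
  P-ext zero    zero    _ = zero , refl , refl
  P-ext (suc x) (suc y) e with P x y (cong (λ { (suc z) → z ; zero → f x }) e)
  ... | z , refl , refl = suc z , refl , refl
... | u , refl , refl = ƛ u , refl , refl
ren-pullback f g h k P (t₁ · t₂) (s₁ · s₂) e
  with ren-pullback f g h k P t₁ s₁ (cong (λ { (z · _) → z ; _ → ren f t₁ }) e)
     | ren-pullback f g h k P t₂ s₂ (cong (λ { (_ · z) → z ; _ → ren f t₂ }) e)
... | u₁ , refl , refl | u₂ , refl , refl = u₁ · u₂ , refl , refl

ren-ext≡ren-suc⁻¹ : ∀ {m n} (ρ : Fin m → Fin n) t s → ren (ext ρ) t ≡ ren suc s → ∃[ u ] t ≡ ren suc u × s ≡ ren ρ u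
ren-ext≡ren-suc⁻¹ ρ = ren-pullback (ext ρ) suc suc ρ λ { (suc x) y refl → x , refl , refl }

ren-suc-injective : ∀ {n} (t s : Term n) → ren suc t ≡ ren suc s → t ≡ s
ren-suc-injective t s e with ren-pullback suc suc (λ z → z) (λ z → z) (λ { x y refl → x , refl , refl }) t s e
... | u , refl , refl = refl

η-ren⁻¹ : ∀ {m n} (ρ : Fin m → Fin n) t {u s} → u ⟶η s → u ≡ ren ρ t → ∃[ t' ] t ⟶η t' × s ≡ ren ρ t'
η-ren⁻¹ ρ (ƛ (t · var zero)) (η-step {t = s} e) refl with ren-ext≡ren-suc⁻¹ ρ t s e
... | u , refl , refl = u , η-step refl , refl
η-ren⁻¹ ρ (ƛ t) (η-ƛ st) refl with η-ren⁻¹ (ext ρ) t st refl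
... | t' , st' , refl = ƛ t' , η-ƛ st' , refl
η-ren⁻¹ ρ (t · u) (η-·ˡ st) refl with η-ren⁻¹ ρ t st refl
... | t' , st' , refl = t' · u , η-·ˡ st' , refl
η-ren⁻¹ ρ (t · u) (η-·ʳ st) refl with η-ren⁻¹ ρ u st refl
... | u' , st' , refl = t · u' , η-·ʳ st' , refl

⇉-ren⁻¹ : ∀ {m n} (ρ : Fin m → Fin n) t {u s} → u ⇉ s → u ≡ ren ρ t → ∃[ t' ] t ⇉ t' × s ≡ ren ρ t'
⇉-ren⁻¹ ρ (var i) ⇉-var refl = var i , ⇉-var , refl
⇉-ren⁻¹ ρ (ƛ t) (⇉-ƛ p) refl with ⇉-ren⁻¹ (ext ρ) t p refl
... | t' , p' , refl = ƛ t' , ⇉-ƛ p' , refl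
⇉-ren⁻¹ ρ (t · u) (⇉-· p q) refl with ⇉-ren⁻¹ ρ t p refl | ⇉-ren⁻¹ ρ u q refl
... | t' , p' , refl | u' , q' , refl = t' · u' , ⇉-· p' q' , refl
⇉-ren⁻¹ ρ (ƛ t · u) (⇉-β p q) refl with ⇉-ren⁻¹ (ext ρ) t p refl | ⇉-ren⁻¹ ρ u q refl
... | t' , p' , refl | u' , q' , refl = t' [ u' ]ₜ , ⇉-β p' q' , sym (ren-[]ₜ ρ t' u')

η-⇉-commute : ∀ {n} → CommuteStep {Term n} {_⟶η_} {_⇉_}
η-⇉-commute (η-step {t = t₀} e) (⇉-ƛ (⇉-· p ⇉-var)) with ⇉-ren⁻¹ suc t₀ p e
... | t₀' , p' , refl = t₀' , p' , return (η-step refl)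
η-⇉-commute (η-step {t = t₀} e) (⇉-ƛ (⇉-β p ⇉-var)) with ⇉-ren⁻¹ suc t₀ (⇉-ƛ p) e
... | ƛ d , p' , refl = ƛ d , p' , subst (λ z → ƛ z ⟶η* ƛ d) (sym (ren-ext-suc-[var-zero] d)) ε
η-⇉-commute (η-ƛ st) (⇉-ƛ p) with η-⇉-commute st p
... | d , p' , sts = ƛ d , ⇉-ƛ p' , gmap ƛ η-ƛ sts
η-⇉-commute (η-·ˡ st) (⇉-· p q) with η-⇉-commute st p
... | d , p' , sts = d · _ , ⇉-· p' q , η*-· sts ε
η-⇉-commute (η-·ˡ (η-ƛ st)) (⇉-β {u' = u'} p q) with η-⇉-commute st p
... | d , p' , sts = d [ u' ]ₜ , ⇉-β p' q , gmap (_[ u' ]ₜ) (η-sub (sub₀ u')) sts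
η-⇉-commute (η-·ˡ (η-step {t = t₀} e)) (⇉-β {u' = u'} (⇉-· p ⇉-var) q) with ⇉-ren⁻¹ suc t₀ p e
... | t₀' , p' , refl = t₀' · u' , ⇉-· p' q , subst (λ z → z · u' ⟶η* t₀' · u') (sym (ren-suc-[]ₜ t₀' u')) ε
η-⇉-commute (η-·ˡ (η-step {t = ƛ t₀} refl)) (⇉-β {u' = u'} (⇉-β p ⇉-var) q) with ⇉-ren⁻¹ suc (ƛ t₀) (⇉-ƛ p) refl
... | ƛ d , ⇉-ƛ p' , refl = d [ u' ]ₜ , ⇉-β p' q , subst (λ z → z [ u' ]ₜ ⟶η* d [ u' ]ₜ) (sym (ren-ext-suc-[var-zero] d)) ε
η-⇉-commute (η-·ʳ st) (⇉-· p q) with η-⇉-commute st q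
... | d , q' , sts = _ · d , ⇉-· p q' , η*-· ε sts
η-⇉-commute (η-·ʳ {u' = u'} st) (⇉-β {t' = t'} p q) with η-⇉-commute st q
... | d , q' , sts = t' [ d ]ₜ , ⇉-β p q' , η*-sub-pointwise η*-sub₀ t'
  where
  η*-sub₀ : ∀ i → sub₀ _ i ⟶η* sub₀ d i
  η*-sub₀ zero    = sts
  η*-sub₀ (suc i) = ε

η-refl-diamond : ∀ {n} → Diamond (Refl.ReflClosure (_⟶η_ {n}))
η-refl-diamond Refl.refl r = _ , r , Refl.refl
η-refl-diamond r Refl.refl = _ , Refl.refl , r
η-refl-diamond Refl.[ s ] Refl.[ s' ] = η-diamond s s'
  where
  η-diamond : ∀ {n} {a b c : Term n} → a ⟶η b → a ⟶η c → ∃[ d ] Refl.ReflClosure _⟶η_ b d × Refl.ReflClosure _⟶η_ c d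
  η-diamond (η-step {t = t} e) (η-step {t = t'} e') = t , Refl.refl , Refl.reflexive (ren-suc-injective t' t (trans (sym e') e))
  η-diamond (η-step {t = t₀} e) (η-ƛ (η-·ˡ st)) with η-ren⁻¹ suc t₀ st e
  ... | w , st' , refl = w , Refl.[ st' ] , Refl.[ η-step refl ]
  η-diamond (η-ƛ (η-·ˡ st)) (η-step {t = t₀} e) with η-ren⁻¹ suc t₀ st e
  ... | w , st' , refl = w , Refl.[ η-step refl ] , Refl.[ st' ]
  η-diamond (η-ƛ s) (η-ƛ s') with η-diamond s s'
  ... | d , r , r' = ƛ d , Refl.map η-ƛ r , Refl.map η-ƛ r'
  η-diamond (η-·ˡ s) (η-·ˡ s') with η-diamond s s'
  ... | d , r , r' = d · _ , Refl.map η-·ˡ r , Refl.map η-·ˡ r'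
  η-diamond (η-·ˡ s) (η-·ʳ s') = _ , Refl.[ η-·ʳ s' ] , Refl.[ η-·ˡ s ]
  η-diamond (η-·ʳ s) (η-·ˡ s') = _ , Refl.[ η-·ˡ s' ] , Refl.[ η-·ʳ s ]
  η-diamond (η-·ʳ s) (η-·ʳ s') with η-diamond s s'
  ... | d , r , r' = _ · d , Refl.map η-·ʳ r , Refl.map η-·ʳ r'

infix 4 _⟶*_

_⟶*_ : ∀ {n} → Term n → Term n → Set
_⟶*_ = Star _⟶_

⟶*-· : ∀ {n} {t t' u u' : Term n} → t ⟶* t' → u ⟶* u' → t · u ⟶* t' · u'
⟶*-· {t' = t'} {u = u} p q = gmap (_· u) ξl p ◅◅ gmap (t' ·_) ξr q

⇉⇒⟶* : ∀ {n} {t s : Term n} → t ⇉ s → t ⟶* s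
⇉⇒⟶* ⇉-var     = ε
⇉⇒⟶* (⇉-ƛ p)   = gmap ƛ ξƛ (⇉⇒⟶* p)
⇉⇒⟶* (⇉-· p q) = ⟶*-· (⇉⇒⟶* p) (⇉⇒⟶* q)
⇉⇒⟶* (⇉-β p q) = ⟶*-· (gmap ƛ ξƛ (⇉⇒⟶* p)) (⇉⇒⟶* q) ◅◅ return β

η⇒⟶ : ∀ {n} {t s : Term n} → t ⟶η s → t ⟶ s
η⇒⟶ (η-step e) = η e
η⇒⟶ (η-ƛ s)    = ξƛ (η⇒⟶ s)
η⇒⟶ (η-·ˡ s)   = ξl (η⇒⟶ s)
η⇒⟶ (η-·ʳ s)   = ξr (η⇒⟶ s)

_⟶η*∪⇉*_ : ∀ {n} → Term n → Term n → Set
_⟶η*∪⇉*_ = Either* {R = _⟶η_} {S = _⇉_}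

⟶η*∪⇉*-map : ∀ {m n} (f : Term m → Term n) → (∀ {x y} → x ⇉ y → f x ⇉ f y) → (∀ {x y} → x ⟶η y → f x ⟶η f y) →
  ∀ {x y} → x ⟶η*∪⇉* y → f x ⟶η*∪⇉* f y
⟶η*∪⇉*-map f _ h (inj₁ p) = inj₁ (gmap f h p)
⟶η*∪⇉*-map f g _ (inj₂ p) = inj₂ (gmap f g p)

⟶⇒⟶η*∪⇉* : ∀ {n} {t s : Term n} → t ⟶ s → t ⟶η*∪⇉* s
⟶⇒⟶η*∪⇉* (β {t = t} {u = u}) = inj₂ (return (⇉-β (⇉-refl t) (⇉-refl u)))
⟶⇒⟶η*∪⇉* (η e)               = inj₁ (return (η-step e))
⟶⇒⟶η*∪⇉* (ξƛ s)              = ⟶η*∪⇉*-map ƛ ⇉-ƛ η-ƛ (⟶⇒⟶η*∪⇉* s)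
⟶⇒⟶η*∪⇉* (ξl {u = u} s)      = ⟶η*∪⇉*-map (_· u) (λ p → ⇉-· p (⇉-refl u)) η-·ˡ (⟶⇒⟶η*∪⇉* s)
⟶⇒⟶η*∪⇉* (ξr {t = t} s)      = ⟶η*∪⇉*-map (t ·_) (⇉-· (⇉-refl t)) η-·ʳ (⟶⇒⟶η*∪⇉* s)

⟶η*∪⇉**⇒⟶* : ∀ {n} {t s : Term n} → Star _⟶η*∪⇉*_ t s → t ⟶* s
⟶η*∪⇉**⇒⟶* ε                = ε
⟶η*∪⇉**⇒⟶* (inj₁ ηs ◅ rest) = gmap (λ x → x) η⇒⟶ ηs ◅◅ ⟶η*∪⇉**⇒⟶* rest
⟶η*∪⇉**⇒⟶* (inj₂ ps ◅ rest) = ⇉*⇒⟶* ps ◅◅ ⟶η*∪⇉**⇒⟶* rest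
  where
  ⇉*⇒⟶* : ∀ {t s} → Star _⇉_ t s → t ⟶* s
  ⇉*⇒⟶* ε        = ε
  ⇉*⇒⟶* (p ◅ ps) = ⇉⇒⟶* p ◅◅ ⇉*⇒⟶* ps

⟶-confluent : ∀ {n} → Confluent (_⟶_ {n})
⟶-confluent rs rs'
  with either*-confluent (refl-diamond⇒confluent η-refl-diamond) (diamond⇒confluent ⇉-diamond)
         (commuteStep⇒commute η-⇉-commute) (gmap (λ x → x) ⟶⇒⟶η*∪⇉* rs) (gmap (λ x → x) ⟶⇒⟶η*∪⇉* rs')
... | d , es , es' = d , ⟶η*∪⇉**⇒⟶* es , ⟶η*∪⇉**⇒⟶* es'

normal-form-unique : ∀ {n} {t s : Term n} → Normal t → Normal s → t ≈βη s → t ≡ s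
normal-form-unique nt ns = conf⇒unf ⟶-confluent (λ (_ , st) → nt st) (λ (_ , st) → ns st)

-- Binary trees and grafting

inner : Tree → ℕ
inner leaf       = 0
inner (node a b) = suc (inner a + inner b)

-- A successor, so that Fin (leaves T) is visibly inhabited (see clamp below).
leaves : Tree → ℕ
leaves T = suc (inner T)

leaves-node : ∀ a b → leaves (node a b) ≡ leaves a + leaves b
leaves-node a b = cong suc (sym (+-suc (inner a) (inner b)))

+-leaves-node : ∀ o a b → o + leaves a + leaves b ≡ o + leaves (node a b)
+-leaves-node o a b = trans (+-assoc o (leaves a) (leaves b)) (cong (o +_) (sym (leaves-node a b)))

sumLeaves : List Tree → ℕ
sumLeaves []       = 0
sumLeaves (S ∷ Ss) = leaves S + sumLeaves Ss

label : Tree → ℕ → Ap ℕ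
label leaf       o = v o
label (node a b) o = label a o ⊛ label b (o + leaves a)

labels : List Tree → ℕ → List (Ap ℕ)
labels []       c = []
labels (S ∷ Ss) c = label S c ∷ labels Ss (c + leaves S)

spine : Tree → List Tree → Tree
spine h []       = h
spine h (x ∷ xs) = spine (node h x) xs

spineAp : ∀ {V : Set} → Ap V → List (Ap V) → Ap V
spineAp h []       = h
spineAp h (x ∷ xs) = spineAp (h ⊛ x) xs

treeArgs : Tree → List Tree
treeArgs leaf       = []
treeArgs (node f g) = treeArgs f ++ [ g ]

spine-∷ʳ : ∀ h xs x → spine h (xs ++ [ x ]) ≡ node (spine h xs) x
spine-∷ʳ h []       x = refl
spine-∷ʳ h (y ∷ xs) x = spine-∷ʳ (node h y) xs x

spine-treeArgs : ∀ T → spine leaf (treeArgs T) ≡ T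
spine-treeArgs leaf       = refl
spine-treeArgs (node f g) = trans (spine-∷ʳ leaf (treeArgs f) g) (cong (λ z → node z g) (spine-treeArgs f))

treeArgs-spine : ∀ h xs → treeArgs (spine h xs) ≡ treeArgs h ++ xs
treeArgs-spine h []       = sym (++-identityʳ _)
treeArgs-spine h (x ∷ xs) = trans (treeArgs-spine (node h x) xs) (++-assoc (treeArgs h) [ x ] xs)

args-spineAp : ∀ {V : Set} (h : Ap V) xs → args (spineAp h xs) ≡ args h ++ xs
args-spineAp h []       = sym (++-identityʳ _)
args-spineAp h (x ∷ xs) = trans (args-spineAp (h ⊛ x) xs) (++-assoc (args h) [ x ] xs)

leaves-spine : ∀ h xs → leaves (spine h xs) ≡ leaves h + sumLeaves xs
leaves-spine h []       = sym (+-identityʳ _)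
leaves-spine h (x ∷ xs) = begin
  leaves (spine (node h x) xs)          ≡⟨ leaves-spine (node h x) xs ⟩
  leaves (node h x) + sumLeaves xs      ≡⟨ cong (_+ sumLeaves xs) (leaves-node h x) ⟩
  leaves h + leaves x + sumLeaves xs    ≡⟨ +-assoc (leaves h) (leaves x) (sumLeaves xs) ⟩
  leaves h + sumLeaves (x ∷ xs)         ∎
  where open ≡-Reasoning

inner≡sumLeaves-treeArgs : ∀ T → inner T ≡ sumLeaves (treeArgs T)
inner≡sumLeaves-treeArgs T = cong pred (trans (cong leaves (sym (spine-treeArgs T))) (leaves-spine leaf (treeArgs T)))

label-spine : ∀ h xs o → label (spine h xs) o ≡ spineAp (label h o) (labels xs (o + leaves h))
label-spine h []       o = refl
label-spine h (x ∷ xs) o = trans (label-spine (node h x) xs o)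
  (cong (λ z → spineAp (label h o ⊛ label x (o + leaves h)) (labels xs z)) (sym (+-leaves-node o h x)))

label≡spineAp-labels-treeArgs : ∀ T o → label T o ≡ spineAp (v o) (labels (treeArgs T) (suc o))
label≡spineAp-labels-treeArgs T o = begin
  label T o                                            ≡⟨ cong (λ z → label z o) (sym (spine-treeArgs T)) ⟩
  label (spine leaf (treeArgs T)) o                    ≡⟨ label-spine leaf (treeArgs T) o ⟩
  spineAp (v o) (labels (treeArgs T) (o + 1))          ≡⟨ cong (λ z → spineAp (v o) (labels (treeArgs T) z)) (+-comm o 1) ⟩
  spineAp (v o) (labels (treeArgs T) (suc o))          ∎
  where open ≡-Reasoning

args-label : ∀ T o → args (label T o) ≡ labels (treeArgs T) (suc o)
args-label T o = trans (cong args (label≡spineAp-labels-treeArgs T o)) (args-spineAp (v o) _)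

headVar-label : ∀ T o → headVar (label T o) ≡ o
headVar-label leaf       o = refl
headVar-label (node a b) o = headVar-label a o

shape-label : ∀ T o → shape (label T o) ≡ T
shape-label leaf       o = refl
shape-label (node a b) o = cong₂ node (shape-label a o) (shape-label b _)

length-labels : ∀ Ss c → length (labels Ss c) ≡ length Ss
length-labels []       c = refl
length-labels (S ∷ Ss) c = cong suc (length-labels Ss _)

label-suc : ∀ T o → label T (suc o) ≡ mapAp suc (label T o)
label-suc leaf       o = refl
label-suc (node a b) o = cong₂ _⊛_ (label-suc a o) (label-suc b (o + leaves a))

labels-suc : ∀ Ss c → labels Ss (suc c) ≡ map (mapAp suc) (labels Ss c)
labels-suc []       c = refl
labels-suc (S ∷ Ss) c = cong₂ _∷_ (label-suc S c) (labels-suc Ss (c + leaves S))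

-- Substitutes the trees of the list for the leaves of T, left to right, while the list lasts, and
-- returns the unused trees.
graft : Tree → List Tree → Tree × List Tree
graft leaf       []       = leaf , []
graft leaf       (S ∷ Ss) = S , Ss
graft (node a b) Ss       =
  node (proj₁ (graft a Ss)) (proj₁ (graft b (proj₂ (graft a Ss)))) , proj₂ (graft b (proj₂ (graft a Ss)))

graftAll : List Tree → List Tree → List Tree × List Tree
graftAll []       Ss = [] , Ss
graftAll (x ∷ xs) Ss =
  proj₁ (graft x Ss) ∷ proj₁ (graftAll xs (proj₂ (graft x Ss))) , proj₂ (graftAll xs (proj₂ (graft x Ss)))

graft-spine : ∀ h xs Ss → graft (spine h xs) Ss ≡
  (spine (proj₁ (graft h Ss)) (proj₁ (graftAll xs (proj₂ (graft h Ss)))) , proj₂ (graftAll xs (proj₂ (graft h Ss))))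
graft-spine h []       Ss = refl
graft-spine h (x ∷ xs) Ss = graft-spine (node h x) xs Ss

length-graftAll : ∀ xs Ss → length (proj₁ (graftAll xs Ss)) ≡ length xs
length-graftAll []       Ss = refl
length-graftAll (x ∷ xs) Ss = cong suc (length-graftAll xs _)

graft-rest≡drop : ∀ T Ss → proj₂ (graft T Ss) ≡ drop (leaves T) Ss
graft-rest≡drop leaf       []       = refl
graft-rest≡drop leaf       (S ∷ Ss) = refl
graft-rest≡drop (node a b) Ss       = begin
  proj₂ (graft b (proj₂ (graft a Ss)))  ≡⟨ graft-rest≡drop b _ ⟩
  drop (leaves b) (proj₂ (graft a Ss))  ≡⟨ cong (drop (leaves b)) (graft-rest≡drop a Ss) ⟩
  drop (leaves b) (drop (leaves a) Ss)  ≡⟨ drop-drop (leaves a) (leaves b) Ss ⟩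
  drop (leaves a + leaves b) Ss         ≡⟨ cong (λ z → drop z Ss) (sym (leaves-node a b)) ⟩
  drop (leaves (node a b)) Ss           ∎
  where open ≡-Reasoning

length-graft-rest : ∀ T Ss → length (proj₂ (graft T Ss)) ≡ length Ss ∸ leaves T
length-graft-rest T Ss = trans (cong length (graft-rest≡drop T Ss)) (length-drop (leaves T) Ss)

m∸o+[n∸[o∸m]]≡m+n∸o : ∀ m n o → (m ∸ o) + (n ∸ (o ∸ m)) ≡ m + n ∸ o
m∸o+[n∸[o∸m]]≡m+n∸o zero    n zero    = refl
m∸o+[n∸[o∸m]]≡m+n∸o zero    n (suc o) = refl
m∸o+[n∸[o∸m]]≡m+n∸o (suc m) n zero    = refl
m∸o+[n∸[o∸m]]≡m+n∸o (suc m) n (suc o) = m∸o+[n∸[o∸m]]≡m+n∸o m n o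

leaves-graft : ∀ T Ss → leaves (proj₁ (graft T Ss)) + sumLeaves (proj₂ (graft T Ss)) ≡ sumLeaves Ss + (leaves T ∸ length Ss)
leaves-graft leaf []       = refl
leaves-graft leaf (S ∷ Ss) = sym (trans (cong (sumLeaves (S ∷ Ss) +_) (0∸n≡0 (length Ss))) (+-identityʳ _))
leaves-graft (node a b) Ss = begin
  leaves (node A B) + sumLeaves Rest                          ≡⟨ cong (_+ sumLeaves Rest) (leaves-node A B) ⟩
  leaves A + leaves B + sumLeaves Rest                        ≡⟨ +-assoc (leaves A) (leaves B) _ ⟩
  leaves A + (leaves B + sumLeaves Rest)                      ≡⟨ cong (leaves A +_) (leaves-graft b Ssₐ) ⟩
  leaves A + (sumLeaves Ssₐ + (leaves b ∸ length Ssₐ))        ≡⟨ +-assoc (leaves A) (sumLeaves Ssₐ) _ ⟨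
  leaves A + sumLeaves Ssₐ + (leaves b ∸ length Ssₐ)
    ≡⟨ cong₂ _+_ (leaves-graft a Ss) (cong (leaves b ∸_) (length-graft-rest a Ss)) ⟩
  sumLeaves Ss + (leaves a ∸ length Ss) + (leaves b ∸ (length Ss ∸ leaves a))   ≡⟨ +-assoc (sumLeaves Ss) _ _ ⟩
  sumLeaves Ss + ((leaves a ∸ length Ss) + (leaves b ∸ (length Ss ∸ leaves a)))
    ≡⟨ cong (sumLeaves Ss +_) (m∸o+[n∸[o∸m]]≡m+n∸o (leaves a) (leaves b) (length Ss)) ⟩
  sumLeaves Ss + (leaves a + leaves b ∸ length Ss)           ≡⟨ cong (λ z → sumLeaves Ss + (z ∸ length Ss)) (leaves-node a b) ⟨
  sumLeaves Ss + (leaves (node a b) ∸ length Ss)             ∎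
  where
  open ≡-Reasoning
  Ssₐ Rest : List Tree
  Ssₐ  = proj₂ (graft a Ss)
  Rest = proj₂ (graft b Ssₐ)
  A B : Tree
  A    = proj₁ (graft a Ss)
  B    = proj₁ (graft b Ssₐ)

drop-labels : ∀ T Ss c → drop (leaves T) (labels Ss c) ≡ labels (proj₂ (graft T Ss)) (c + leaves (proj₁ (graft T Ss)))
drop-labels leaf       []       c = refl
drop-labels leaf       (S ∷ Ss) c = refl
drop-labels (node a b) Ss       c = begin
  drop (leaves (node a b)) (labels Ss c)          ≡⟨ cong (λ z → drop z (labels Ss c)) (leaves-node a b) ⟩
  drop (leaves a + leaves b) (labels Ss c)        ≡⟨ drop-drop (leaves a) (leaves b) (labels Ss c) ⟨
  drop (leaves b) (drop (leaves a) (labels Ss c)) ≡⟨ cong (drop (leaves b)) (drop-labels a Ss c) ⟩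
  drop (leaves b) (labels Ssₐ (c + leaves A))     ≡⟨ drop-labels b Ssₐ (c + leaves A) ⟩
  labels (proj₂ (graft b Ssₐ)) (c + leaves A + leaves (proj₁ (graft b Ssₐ)))
    ≡⟨ cong (labels _) (+-leaves-node c A _) ⟩
  labels (proj₂ (graft (node a b) Ss)) (c + leaves (proj₁ (graft (node a b) Ss))) ∎
  where
  open ≡-Reasoning
  A : Tree
  A   = proj₁ (graft a Ss)
  Ssₐ : List Tree
  Ssₐ = proj₂ (graft a Ss)

-- ρ sends o, o + 1, … to the trees of Ss labelled from c on, and then to the next variables.
GraftEnv : (ℕ → Ap ℕ) → ℕ → List Tree → ℕ → Set
GraftEnv ρ o []       c = ∀ i → ρ (o + i) ≡ v (c + i)
GraftEnv ρ o (S ∷ Ss) c = ρ o ≡ label S c × GraftEnv ρ (suc o) Ss (c + leaves S)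

substAp-label-graft : ∀ T ρ o Ss c → GraftEnv ρ o Ss c →
  substAp ρ (label T o) ≡ label (proj₁ (graft T Ss)) c
  × GraftEnv ρ (o + leaves T) (proj₂ (graft T Ss)) (c + leaves (proj₁ (graft T Ss)))
substAp-label-graft leaf ρ o [] c env =
  trans (cong ρ (sym (+-identityʳ o))) (trans (env 0) (cong v (+-identityʳ c))) ,
  λ i → trans (cong ρ (+-assoc o 1 i)) (trans (env (suc i)) (cong v (sym (+-assoc c 1 i))))
substAp-label-graft leaf ρ o (S ∷ Ss) c (ρo , env) = ρo , subst (λ z → GraftEnv ρ z Ss (c + leaves S)) (+-comm 1 o) env
substAp-label-graft (node a b) ρ o Ss c env with substAp-label-graft a ρ o Ss c env
... | eq₁ , env₁ with substAp-label-graft b ρ (o + leaves a) (proj₂ (graft a Ss)) (c + leaves (proj₁ (graft a Ss))) env₁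
...   | eq₂ , env₂ =
  cong₂ _⊛_ eq₁ eq₂ ,
  subst₂ (λ x y → GraftEnv ρ x (proj₂ (graft b (proj₂ (graft a Ss)))) y)
         (+-leaves-node o a b) (+-leaves-node c (proj₁ (graft a Ss)) (proj₁ (graft b (proj₂ (graft a Ss))))) env₂

nthOr : ∀ {A : Set} → A → ℕ → List A → A
nthOr d i       []       = d
nthOr d zero    (x ∷ xs) = x
nthOr d (suc i) (x ∷ xs) = nthOr d i xs

graftEnv-nthOr : ∀ Ss ρ o c → (∀ i → ρ (o + i) ≡ nthOr (v (c + sumLeaves Ss + (i ∸ length Ss))) i (labels Ss c)) →
  GraftEnv ρ o Ss c
graftEnv-nthOr []       ρ o c h i = trans (h i) (cong (λ z → v (z + i)) (+-identityʳ c))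
graftEnv-nthOr (S ∷ Ss) ρ o c h =
  trans (cong ρ (sym (+-identityʳ o))) (h 0) ,
  graftEnv-nthOr Ss ρ (suc o) (c + leaves S) λ i → trans (cong ρ (sym (+-suc o i))) (trans (h (suc i))
    (cong (λ z → nthOr (v (z + (i ∸ length Ss))) i (labels Ss (c + leaves S))) (sym (+-assoc c (leaves S) (sumLeaves Ss)))))

compose : Tree → Tree → Tree
compose T' T = spine (proj₁ (graft T (treeArgs T'))) (proj₂ (graft T (treeArgs T')))

LastArgApp : Tree → Set
LastArgApp T = ∃[ f ] ∃[ a ] ∃[ b ] T ≡ node f (node a b)

drop-∷ʳ : ∀ {A : Set} i (xs : List A) y → drop i (xs ++ [ y ]) ≡ [] ⊎ ∃[ ys ] drop i (xs ++ [ y ]) ≡ ys ++ [ y ]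
drop-∷ʳ zero    xs       y = inj₂ (xs , refl)
drop-∷ʳ (suc i) []       y = inj₁ (drop-[] i)
drop-∷ʳ (suc i) (x ∷ xs) y = drop-∷ʳ i xs y

compose-LastArgApp : ∀ T' T → LastArgApp T' → LastArgApp T → LastArgApp (compose T' T)
compose-LastArgApp T' T (f' , a' , b' , refl) (f , a , b , refl)
  with drop-∷ʳ (leaves (node f (node a b))) (treeArgs f') (node a' b')
... | inj₁ e = _ , _ , _ , cong (spine _) (trans (graft-rest≡drop (node f (node a b)) _) e)
... | inj₂ (ys , e) =
  _ , a' , b' , trans (cong (spine _) (trans (graft-rest≡drop (node f (node a b)) _) e)) (spine-∷ʳ _ ys (node a' b'))

LastArgApp⇒treeArgs-∷ : ∀ T → LastArgApp T → ∃[ S ] ∃[ Ss ] treeArgs T ≡ S ∷ Ss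
LastArgApp⇒treeArgs-∷ T (f , a , b , refl) with treeArgs f
... | []     = node a b , [] , refl
... | S ∷ Ss = S , Ss ++ [ node a b ] , refl

-- β-reduction of applied λ-abstractions

spineTm : ∀ {k} → Term k → List (Term k) → Term k
spineTm t []       = t
spineTm t (u ∷ us) = spineTm (t · u) us

spineTm-++ : ∀ {k} (t : Term k) xs ys → spineTm t (xs ++ ys) ≡ spineTm (spineTm t xs) ys
spineTm-++ t []       ys = refl
spineTm-++ t (x ∷ xs) ys = spineTm-++ (t · x) xs ys

⟶*-spineTm : ∀ {k} {t t' : Term k} us → t ⟶* t' → spineTm t us ⟶* spineTm t' us
⟶*-spineTm []       r = r
⟶*-spineTm (u ∷ us) r = ⟶*-spineTm us (⟶*-· r ε)

ren-spineTm : ∀ {m n} (ρ : Fin m → Fin n) t us → ren ρ (spineTm t us) ≡ spineTm (ren ρ t) (map (ren ρ) us)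
ren-spineTm ρ t []       = refl
ren-spineTm ρ t (u ∷ us) = ren-spineTm ρ (t · u) us

weaken : ∀ {k} → Term 0 → Term k
weaken = ren (λ ())

ren-weaken : ∀ {m n} (ρ : Fin m → Fin n) (t : Term 0) → ren ρ (weaken t) ≡ weaken t
ren-weaken ρ t = trans (ren-ren _ ρ t) (ren-cong (λ ()) t)

lamsArgs : ∀ {k} n → (Fin n → Term k) → List (Term k)
lamsArgs zero    σ = []
lamsArgs (suc n) σ = lamsArgs n (λ i → σ (suc i)) ++ [ σ zero ]

lamsArgs-cong : ∀ {k} n {σ τ : Fin n → Term k} → (∀ i → σ i ≡ τ i) → lamsArgs n σ ≡ lamsArgs n τ
lamsArgs-cong zero    h = refl
lamsArgs-cong (suc n) h = cong₂ _++_ (lamsArgs-cong n (λ i → h (suc i))) (cong [_] (h zero))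

map-lamsArgs : ∀ {k l} n (f : Term k → Term l) (σ : Fin n → Term k) → map f (lamsArgs n σ) ≡ lamsArgs n (λ i → f (σ i))
map-lamsArgs zero    f σ = refl
map-lamsArgs (suc n) f σ = trans (map-++ f (lamsArgs n _) _) (cong (_++ _) (map-lamsArgs n f _))

lams-β* : ∀ n (t : Term n) {k} (σ : Fin n → Term k) rest →
  spineTm (weaken (lams n t)) (lamsArgs n σ ++ rest) ⟶* spineTm (sub σ t) rest
lams-β* zero t σ rest =
  subst (λ z → spineTm (weaken t) rest ⟶* spineTm z rest) (trans (ren-as-sub _ t) (sub-cong (λ ()) t)) ε
lams-β* (suc n) t σ rest =
  subst₂ _⟶*_ (cong (spineTm (weaken (lams n (ƛ t)))) (sym (++-assoc (lamsArgs n (λ i → σ (suc i))) [ σ zero ] rest)))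
              (cong (λ z → spineTm z rest) β-sub)
              (lams-β* n (ƛ t) (λ i → σ (suc i)) (σ zero ∷ rest) ◅◅ ⟶*-spineTm rest (return β))
  where
  β-sub : sub (exts (λ i → σ (suc i))) t [ σ zero ]ₜ ≡ sub σ t
  β-sub = trans (sub-sub (exts (λ i → σ (suc i))) (sub₀ (σ zero)) t) (sub-cong exts-sub₀ t)
    where
    exts-sub₀ : ∀ i → sub (sub₀ (σ zero)) (exts (λ i → σ (suc i)) i) ≡ σ i
    exts-sub₀ zero    = refl
    exts-sub₀ (suc i) = ren-suc-[]ₜ (σ (suc i)) (σ zero)

≈βη-lams : ∀ n {t s : Term n} → t ≈βη s → lams n t ≈βη lams n s
≈βη-lams zero    e = e
≈βη-lams (suc n) e = ≈βη-lams n (EqClosure.gmap ƛ ξƛ e)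

⟶*⇒≈βη : ∀ {n} {t s : Term n} → t ⟶* s → t ≈βη s
⟶*⇒≈βη = gmap (λ x → x) fwd

≈βη-η-expand : ∀ p (t : Term 0) → t ≈βη lams p (spineTm (weaken t) (lamsArgs p var))
≈βη-η-expand zero    t = subst (t ≈βη_) (sym (ren-id (λ ()) t)) ε
≈βη-η-expand (suc p) t =
  ≈βη-η-expand p t ◅◅
  subst (λ z → lams p body ≈βη lams p (ƛ z)) (sym (spineTm-++ (weaken t) (lamsArgs p (λ i → var (suc i))) [ var zero ]))
        (≈βη-lams p (return (bwd (η weaken-body))))
  where
  body : Term p
  body = spineTm (weaken t) (lamsArgs p var)
  weaken-body : spineTm (weaken t) (lamsArgs p (λ i → var (suc i))) ≡ ren suc body
  weaken-body = sym (trans (ren-spineTm suc (weaken t) (lamsArgs p var))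
                           (cong₂ spineTm (ren-weaken suc t) (map-lamsArgs p (ren suc) var)))

⟦_⟧⟨_⟩ : ∀ {k} → Ap ℕ → (ℕ → Term k) → Term k
⟦ v j   ⟧⟨ f ⟩ = f j
⟦ a ⊛ b ⟧⟨ f ⟩ = ⟦ a ⟧⟨ f ⟩ · ⟦ b ⟧⟨ f ⟩

⟦spineAp⟧ : ∀ {k} (h : Ap ℕ) xs (f : ℕ → Term k) → ⟦ spineAp h xs ⟧⟨ f ⟩ ≡ spineTm ⟦ h ⟧⟨ f ⟩ (map ⟦_⟧⟨ f ⟩ xs)
⟦spineAp⟧ h []       f = refl
⟦spineAp⟧ h (x ∷ xs) f = ⟦spineAp⟧ (h ⊛ x) xs f

⟦substAp⟧ : ∀ {k} (ρ : ℕ → Ap ℕ) e (f : ℕ → Term k) → ⟦ substAp ρ e ⟧⟨ f ⟩ ≡ ⟦ e ⟧⟨ (λ j → ⟦ ρ j ⟧⟨ f ⟩) ⟩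
⟦substAp⟧ ρ (v j)   f = refl
⟦substAp⟧ ρ (a ⊛ b) f = cong₂ _·_ (⟦substAp⟧ ρ a f) (⟦substAp⟧ ρ b f)

AllVars : (ℕ → Set) → Ap ℕ → Set
AllVars P (v j)   = P j
AllVars P (a ⊛ b) = AllVars P a × AllVars P b

AllVars-mono : ∀ {P Q : ℕ → Set} → (∀ j → P j → Q j) → ∀ e → AllVars P e → AllVars Q e
AllVars-mono h (v j)   p       = h j p
AllVars-mono h (a ⊛ b) (p , q) = AllVars-mono h a p , AllVars-mono h b q

⟦⟧-cong : ∀ {k} {P : ℕ → Set} {f g : ℕ → Term k} e → AllVars P e → (∀ j → P j → f j ≡ g j) → ⟦ e ⟧⟨ f ⟩ ≡ ⟦ e ⟧⟨ g ⟩
⟦⟧-cong (v j)   p       h = h j p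
⟦⟧-cong (a ⊛ b) (p , q) h = cong₂ _·_ (⟦⟧-cong a p h) (⟦⟧-cong b q h)

map-⟦⟧-cong : ∀ {k} {P : ℕ → Set} {f g : ℕ → Term k} xs → All (AllVars P) xs → (∀ j → P j → f j ≡ g j) →
  map ⟦_⟧⟨ f ⟩ xs ≡ map ⟦_⟧⟨ g ⟩ xs
map-⟦⟧-cong []       []       h = refl
map-⟦⟧-cong (x ∷ xs) (p ∷ ps) h = cong₂ _∷_ (⟦⟧-cong x p h) (map-⟦⟧-cong xs ps h)

InRange : ℕ → ℕ → ℕ → Set
InRange lo hi j = lo ≤ j × j < hi

label-InRange : ∀ T o → AllVars (InRange o (o + leaves T)) (label T o)
label-InRange leaf       o = ≤-refl , subst (o <_) (+-comm 1 o) ≤-refl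
label-InRange (node a b) o =
  AllVars-mono (λ j (lo , hi) → lo , <-≤-trans hi (subst (o + leaves a ≤_) (+-leaves-node o a b) (m≤m+n _ _)))
               (label a o) (label-InRange a o) ,
  AllVars-mono (λ j (lo , hi) → ≤-trans (m≤m+n o (leaves a)) lo , subst (j <_) (+-leaves-node o a b) hi)
               (label b _) (label-InRange b (o + leaves a))

labels-InRange : ∀ Ss c → All (AllVars (InRange c (c + sumLeaves Ss))) (labels Ss c)
labels-InRange []       c = []
labels-InRange (S ∷ Ss) c =
  AllVars-mono (λ j (lo , hi) → lo , <-≤-trans hi (subst (c + leaves S ≤_) (+-assoc c _ _) (m≤m+n _ _)))
               (label S c) (label-InRange S c) ∷
  All.map (λ {e} → AllVars-mono (λ j (lo , hi) → ≤-trans (m≤m+n c (leaves S)) lo , subst (j <_) (+-assoc c _ _) hi) e)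
          (labels-InRange Ss (c + leaves S))

clamp : (m : ℕ) → ℕ → Fin (suc m)
clamp m       zero    = zero
clamp zero    (suc j) = zero
clamp (suc m) (suc j) = suc (clamp m j)

clamp-toℕ : ∀ m (x : Fin (suc m)) → clamp m (toℕ x) ≡ x
clamp-toℕ m       zero    = refl
clamp-toℕ (suc m) (suc x) = cong suc (clamp-toℕ m x)

toℕ-clamp : ∀ m j → j ≤ m → toℕ (clamp m j) ≡ j
toℕ-clamp m       zero    _       = refl
toℕ-clamp (suc m) (suc j) (s≤s h) = cong suc (toℕ-clamp m j h)

-- The body of the normal form whose tree is T: the leaves of T become x₁, x₂, … from left to right.
nfBody : (T : Tree) → Ap (Fin (leaves T))
nfBody T = mapAp (clamp (inner T)) (label T 0)

sub-embed-clamp : ∀ {m k} (σ : Fin (suc m) → Term k) e →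
  sub σ (embed (mapAp (clamp m) e)) ≡ ⟦ e ⟧⟨ (λ j → σ (opposite (clamp m j))) ⟩
sub-embed-clamp σ (v j)   = refl
sub-embed-clamp σ (a ⊛ b) = cong₂ _·_ (sub-embed-clamp σ a) (sub-embed-clamp σ b)

embed-clamp : ∀ {m} e → embed (mapAp (clamp m) e) ≡ ⟦ e ⟧⟨ (λ j → var (opposite (clamp m j))) ⟩
embed-clamp (v j)   = refl
embed-clamp (a ⊛ b) = cong₂ _·_ (embed-clamp a) (embed-clamp b)

upFrom : ℕ → ℕ → List ℕ
upFrom s zero    = []
upFrom s (suc c) = s ∷ upFrom (suc s) c

upFrom-suc : ∀ s c → upFrom s (suc c) ≡ upFrom s c ++ [ s + c ]
upFrom-suc s zero    = cong [_] (sym (+-identityʳ s))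
upFrom-suc s (suc c) = cong (s ∷_) (trans (upFrom-suc (suc s) c) (cong (λ z → upFrom (suc s) c ++ [ z ]) (sym (+-suc s c))))

upFrom-+ : ∀ s a b → upFrom s (a + b) ≡ upFrom s a ++ upFrom (s + a) b
upFrom-+ s zero    b = cong (λ z → upFrom z b) (sym (+-identityʳ s))
upFrom-+ s (suc a) b = cong (s ∷_) (trans (upFrom-+ (suc s) a b) (cong (λ z → upFrom (suc s) a ++ upFrom z b) (sym (+-suc s a))))

length-upFrom : ∀ s c → length (upFrom s c) ≡ c
length-upFrom s zero    = refl
length-upFrom s (suc c) = cong suc (length-upFrom (suc s) c)

map-upFrom-suc : ∀ {A : Set} (h : ℕ → A) s c → map h (upFrom (suc s) c) ≡ map (λ j → h (suc j)) (upFrom s c)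
map-upFrom-suc h s zero    = refl
map-upFrom-suc h s (suc c) = cong (h (suc s) ∷_) (map-upFrom-suc h (suc s) c)

nthOr-map-upFrom : ∀ {A : Set} (d : A) (f : ℕ → A) c K j → j < K → nthOr d j (map f (upFrom c K)) ≡ f (c + j)
nthOr-map-upFrom d f c (suc K) zero    _       = cong f (sym (+-identityʳ c))
nthOr-map-upFrom d f c (suc K) (suc j) (s≤s h) = trans (nthOr-map-upFrom d f (suc c) K j h) (cong f (sym (+-suc c j)))

map-nthOr-upFrom : ∀ {A : Set} (d : A) us → map (λ j → nthOr d j us) (upFrom 0 (length us)) ≡ us
map-nthOr-upFrom d []       = refl
map-nthOr-upFrom d (u ∷ us) = cong (u ∷_) (trans (map-upFrom-suc (λ j → nthOr d j (u ∷ us)) 0 (length us)) (map-nthOr-upFrom d us))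

nthOr-take : ∀ {A : Set} (d : A) n xs j → j < n → nthOr d j (take n xs) ≡ nthOr d j xs
nthOr-take d (suc n) []       j       _       = refl
nthOr-take d (suc n) (x ∷ xs) zero    _       = refl
nthOr-take d (suc n) (x ∷ xs) (suc j) (s≤s h) = nthOr-take d n xs j h

nthOr-beyond : ∀ {A : Set} (d : A) i xs → length xs ≤ i → nthOr d i xs ≡ d
nthOr-beyond d i       []       _        = refl
nthOr-beyond d (suc i) (x ∷ xs) (s≤s le) = nthOr-beyond d i xs le

drop-++-exact : ∀ {A : Set} n (xs ys : List A) → length ys ≡ n ∸ length xs → drop n (xs ++ ys) ≡ drop n xs
drop-++-exact n       []       []       _ = refl
drop-++-exact (suc n) []       (y ∷ ys) h = trans (drop-all n ys (≤-reflexive (suc-injective h))) (sym (drop-[] (suc n)))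
drop-++-exact zero    (x ∷ xs) []       _ = cong (x ∷_) (++-identityʳ xs)
drop-++-exact (suc n) (x ∷ xs) ys       h = drop-++-exact n xs ys h

lamsArgs-opposite : ∀ {k} n (g : ℕ → Term k) → lamsArgs n (λ i → g (toℕ (opposite i))) ≡ map g (upFrom 0 n)
lamsArgs-opposite zero    g = refl
lamsArgs-opposite (suc n) g = begin
  lamsArgs n (λ i → g (toℕ (opposite (suc i)))) ++ [ g (toℕ (opposite {suc n} zero)) ]
    ≡⟨ cong₂ _++_ (trans (lamsArgs-cong n (λ i → cong g (toℕ-inject₁ (opposite i)))) (lamsArgs-opposite n g))
                  (cong (λ z → [ g z ]) (toℕ-fromℕ n)) ⟩
  map g (upFrom 0 n) ++ [ g n ]       ≡⟨ map-++ g (upFrom 0 n) [ n ] ⟨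
  map g (upFrom 0 n ++ [ n ])         ≡⟨ cong (map g) (upFrom-suc 0 n) ⟨
  map g (upFrom 0 (suc n))            ∎
  where open ≡-Reasoning

lamsArgs-nthOr : ∀ {k} n (d : Term k) us → length us ≡ n → lamsArgs n (λ i → nthOr d (toℕ (opposite i)) us) ≡ us
lamsArgs-nthOr n d us refl = trans (lamsArgs-opposite (length us) (λ j → nthOr d j us)) (map-nthOr-upFrom d us)

nthOr-⟦⟧-++-upFrom : ∀ {k} (d : Term k) (f : ℕ → Term k) xs c K j → j < length xs + K →
  nthOr d j (map ⟦_⟧⟨ f ⟩ xs ++ map f (upFrom c K)) ≡ ⟦ nthOr (v (c + (j ∸ length xs))) j xs ⟧⟨ f ⟩
nthOr-⟦⟧-++-upFrom d f []       c K j       h       = nthOr-map-upFrom d f c K j h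
nthOr-⟦⟧-++-upFrom d f (x ∷ xs) c K zero    _       = refl
nthOr-⟦⟧-++-upFrom d f (x ∷ xs) c K (suc j) (s≤s h) = nthOr-⟦⟧-++-upFrom d f xs c K j h

-- The normal form of an application

leaves-compose : ∀ T' T → leaves (compose T' T) ≡ sumLeaves (treeArgs T') + (leaves T ∸ length (treeArgs T'))
leaves-compose T' T =
  trans (leaves-spine (proj₁ (graft T (treeArgs T'))) (proj₂ (graft T (treeArgs T')))) (leaves-graft T (treeArgs T'))

-- Applying the normal form with tree T' to the one with tree T, the first λ of T' consumes the
-- whole of T, the next ones the variables W₁ standing for the other leaves of T'; then T consumes
-- the arguments of T' and, if they are too few, the further variables W₂.
module Application (T' T : Tree) where

  Ss : List Tree
  Ss = treeArgs T'

  Tq : Tree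
  Tq = compose T' T

  k' m' n p : ℕ
  k' = length Ss
  m' = sumLeaves Ss
  n  = leaves T
  p  = leaves Tq

  L' L : Term 0
  L' = lams (leaves T') (embed (nfBody T'))
  L  = lams n (embed (nfBody T))

  x : ℕ → Term p
  x j = var (opposite (clamp (inner Tq) j))

  W₁ W₂ args' : List (Term p)
  W₁    = map x (upFrom 0 m')
  W₂    = map x (upFrom m' (n ∸ k'))
  args' = map ⟦_⟧⟨ x ⟩ (labels Ss 0)

  lamsArgs-vars : lamsArgs p var ≡ W₁ ++ W₂
  lamsArgs-vars = begin
    lamsArgs p var                        ≡⟨ lamsArgs-cong p var≡x ⟩
    lamsArgs p (λ i → x (toℕ (opposite i))) ≡⟨ lamsArgs-opposite p x ⟩
    map x (upFrom 0 p)                    ≡⟨ cong (λ z → map x (upFrom 0 z)) (leaves-compose T' T) ⟩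
    map x (upFrom 0 (m' + (n ∸ k')))      ≡⟨ cong (map x) (upFrom-+ 0 m' (n ∸ k')) ⟩
    map x (upFrom 0 m' ++ upFrom m' (n ∸ k')) ≡⟨ map-++ x (upFrom 0 m') _ ⟩
    W₁ ++ W₂                              ∎
    where
    open ≡-Reasoning
    var≡x : ∀ i → var i ≡ x (toℕ (opposite i))
    var≡x i = cong var (sym (trans (cong opposite (clamp-toℕ (inner Tq) (opposite i))) (opposite-involutive i)))

  σ₁ : Fin (leaves T') → Term p
  σ₁ i = nthOr (var zero) (toℕ (opposite i)) (weaken L ∷ W₁)

  sub-σ₁-body' : sub σ₁ (embed (nfBody T')) ≡ spineTm (weaken L) args'
  sub-σ₁-body' = begin
    sub σ₁ (embed (nfBody T'))                       ≡⟨ sub-embed-clamp σ₁ (label T' 0) ⟩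
    ⟦ label T' 0 ⟧⟨ (λ j → σ₁ (opposite (clamp (inner T') j))) ⟩ ≡⟨ ⟦⟧-cong (label T' 0) (label-InRange T' 0) σ₁-clamp ⟩
    ⟦ label T' 0 ⟧⟨ env ⟩                           ≡⟨ cong ⟦_⟧⟨ env ⟩ (label≡spineAp-labels-treeArgs T' 0) ⟩
    ⟦ spineAp (v 0) (labels Ss 1) ⟧⟨ env ⟩          ≡⟨ ⟦spineAp⟧ (v 0) (labels Ss 1) env ⟩
    spineTm (weaken L) (map ⟦_⟧⟨ env ⟩ (labels Ss 1)) ≡⟨ cong (spineTm (weaken L)) ⟦labels⟧ ⟩
    spineTm (weaken L) args'                           ∎
    where
    open ≡-Reasoning
    env : ℕ → Term p
    env j = nthOr (var zero) j (weaken L ∷ W₁)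
    σ₁-clamp : ∀ j → InRange 0 (0 + leaves T') j → σ₁ (opposite (clamp (inner T') j)) ≡ env j
    σ₁-clamp j (_ , lt) =
      cong (λ z → nthOr (var zero) z (weaken L ∷ W₁))
           (trans (cong toℕ (opposite-involutive (clamp (inner T') j))) (toℕ-clamp (inner T') j (≤-pred lt)))
    ⟦labels⟧ : map ⟦_⟧⟨ env ⟩ (labels Ss 1) ≡ args'
    ⟦labels⟧ = begin
      map ⟦_⟧⟨ env ⟩ (labels Ss 1)                     ≡⟨ cong (map ⟦_⟧⟨ env ⟩) (labels-suc Ss 0) ⟩
      map ⟦_⟧⟨ env ⟩ (map (mapAp suc) (labels Ss 0))   ≡⟨ map-∘ (labels Ss 0) ⟨
      map (λ e → ⟦ mapAp suc e ⟧⟨ env ⟩) (labels Ss 0) ≡⟨ map-cong (λ e → ⟦substAp⟧ (λ j → v (suc j)) e env) (labels Ss 0) ⟩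
      map ⟦_⟧⟨ (λ j → env (suc j)) ⟩ (labels Ss 0)     ≡⟨ map-⟦⟧-cong (labels Ss 0) (labels-InRange Ss 0)
                                                           (λ j (_ , lt) → nthOr-map-upFrom (var zero) x 0 m' j lt) ⟩
      args'                                               ∎

  β-phase₁ : spineTm (weaken L') (weaken L ∷ lamsArgs p var) ⟶* spineTm (weaken L) (args' ++ W₂)
  β-phase₁ = subst₂ _⟶*_ (cong (spineTm (weaken L')) args-split)
                         (trans (cong (λ z → spineTm z W₂) sub-σ₁-body') (sym (spineTm-++ (weaken L) args' W₂)))
                         (lams-β* (leaves T') (embed (nfBody T')) σ₁ W₂)
    where
    length-args₁ : length (weaken L ∷ W₁) ≡ leaves T'
    length-args₁ = cong suc (trans (length-map x (upFrom 0 m')) (trans (length-upFrom 0 m') (sym (inner≡sumLeaves-treeArgs T'))))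
    args-split : lamsArgs (leaves T') σ₁ ++ W₂ ≡ weaken L ∷ lamsArgs p var
    args-split = trans (cong (_++ W₂) (lamsArgs-nthOr _ (var zero) (weaken L ∷ W₁) length-args₁)) (cong (weaken L ∷_) (sym lamsArgs-vars))

  grafted : Tree
  grafted = proj₁ (graft T Ss)

  Rest : List Tree
  Rest = proj₂ (graft T Ss)

  taken : List (Term p)
  taken = take n (args' ++ W₂)

  σ₂ : Fin n → Term p
  σ₂ i = nthOr (var zero) (toℕ (opposite i)) taken

  length-args' : length args' ≡ k'
  length-args' = trans (length-map ⟦_⟧⟨ x ⟩ (labels Ss 0)) (length-labels Ss 0)

  length-W₂ : length W₂ ≡ n ∸ k'
  length-W₂ = trans (length-map x (upFrom m' (n ∸ k'))) (length-upFrom m' (n ∸ k'))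

  n≤length-args'++W₂ : n ≤ length (args' ++ W₂)
  n≤length-args'++W₂ = subst (n ≤_) (sym (trans (length-++ args') (cong₂ _+_ length-args' length-W₂))) (m≤n+m∸n n k')

  sub-σ₂-body : sub σ₂ (embed (nfBody T)) ≡ ⟦ label grafted 0 ⟧⟨ x ⟩
  sub-σ₂-body = begin
    sub σ₂ (embed (nfBody T))                                      ≡⟨ sub-embed-clamp σ₂ (label T 0) ⟩
    ⟦ label T 0 ⟧⟨ (λ j → σ₂ (opposite (clamp (inner T) j))) ⟩     ≡⟨ ⟦⟧-cong (label T 0) (label-InRange T 0) σ₂-clamp ⟩
    ⟦ label T 0 ⟧⟨ (λ j → ⟦ ρ j ⟧⟨ x ⟩) ⟩                          ≡⟨ ⟦substAp⟧ ρ (label T 0) x ⟨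
    ⟦ substAp ρ (label T 0) ⟧⟨ x ⟩                                 ≡⟨ cong ⟦_⟧⟨ x ⟩ (proj₁ (substAp-label-graft T ρ 0 Ss 0 env)) ⟩
    ⟦ label grafted 0 ⟧⟨ x ⟩                                            ∎
    where
    open ≡-Reasoning
    ρ : ℕ → Ap ℕ
    ρ j = nthOr (v (m' + (j ∸ k'))) j (labels Ss 0)
    env : GraftEnv ρ 0 Ss 0
    env = graftEnv-nthOr Ss ρ 0 0 (λ i → refl)
    σ₂-clamp : ∀ j → InRange 0 (0 + n) j → σ₂ (opposite (clamp (inner T) j)) ≡ ⟦ ρ j ⟧⟨ x ⟩
    σ₂-clamp j (_ , lt) = begin
      σ₂ (opposite (clamp (inner T) j))
        ≡⟨ cong (λ z → nthOr (var zero) z taken) (trans (cong toℕ (opposite-involutive _)) (toℕ-clamp (inner T) j (≤-pred lt))) ⟩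
      nthOr (var zero) j taken                    ≡⟨ nthOr-take (var zero) n (args' ++ W₂) j lt ⟩
      nthOr (var zero) j (args' ++ W₂)
        ≡⟨ nthOr-⟦⟧-++-upFrom (var zero) x (labels Ss 0) m' (n ∸ k') j
             (<-≤-trans lt (subst (n ≤_) (cong (_+ (n ∸ k')) (sym (length-labels Ss 0))) (m≤n+m∸n n k'))) ⟩
      ⟦ nthOr (v (m' + (j ∸ length (labels Ss 0)))) j (labels Ss 0) ⟧⟨ x ⟩
        ≡⟨ cong (λ z → ⟦ nthOr (v (m' + (j ∸ z))) j (labels Ss 0) ⟧⟨ x ⟩) (length-labels Ss 0) ⟩
      ⟦ ρ j ⟧⟨ x ⟩                              ∎

  restLabels : List (Ap ℕ)
  restLabels = labels Rest (0 + leaves grafted)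

  drop-args'++W₂ : drop n (args' ++ W₂) ≡ map ⟦_⟧⟨ x ⟩ restLabels
  drop-args'++W₂ = begin
    drop n (args' ++ W₂)                            ≡⟨ drop-++-exact n args' W₂ (trans length-W₂ (cong (n ∸_) (sym length-args'))) ⟩
    drop n args'                                    ≡⟨ drop-map n (labels Ss 0) ⟩
    map ⟦_⟧⟨ x ⟩ (drop n (labels Ss 0))          ≡⟨ cong (map ⟦_⟧⟨ x ⟩) (drop-labels T Ss 0) ⟩
    map ⟦_⟧⟨ x ⟩ restLabels                      ∎
    where open ≡-Reasoning

  embed-nfBody-compose : embed (nfBody Tq) ≡ spineTm ⟦ label grafted 0 ⟧⟨ x ⟩ (map ⟦_⟧⟨ x ⟩ restLabels)
  embed-nfBody-compose = begin
    embed (nfBody Tq)                                  ≡⟨ embed-clamp (label Tq 0) ⟩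
    ⟦ label Tq 0 ⟧⟨ x ⟩                                ≡⟨ cong ⟦_⟧⟨ x ⟩ (label-spine grafted Rest 0) ⟩
    ⟦ spineAp (label grafted 0) restLabels ⟧⟨ x ⟩      ≡⟨ ⟦spineAp⟧ (label grafted 0) restLabels x ⟩
    spineTm ⟦ label grafted 0 ⟧⟨ x ⟩ (map ⟦_⟧⟨ x ⟩ restLabels) ∎
    where open ≡-Reasoning

  β-phase₂ : spineTm (weaken L) (args' ++ W₂) ⟶* embed (nfBody Tq)
  β-phase₂ = subst₂ _⟶*_
    (cong (spineTm (weaken L)) (trans (cong (_++ drop n (args' ++ W₂)) args₂) (take++drop≡id n (args' ++ W₂))))
    (trans (cong₂ spineTm sub-σ₂-body drop-args'++W₂) (sym embed-nfBody-compose))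
    (lams-β* n (embed (nfBody T)) σ₂ (drop n (args' ++ W₂)))
    where
    args₂ : lamsArgs n σ₂ ≡ taken
    args₂ = lamsArgs-nthOr n (var zero) taken (trans (length-take n (args' ++ W₂)) (m≤n⇒m⊓n≡m n≤length-args'++W₂))

  compose-≈βη : (L' · L) ≈βη lams p (embed (nfBody Tq))
  compose-≈βη = ≈βη-η-expand p (L' · L) ◅◅ ≈βη-lams p (⟶*⇒≈βη (β-phase₁ ◅◅ β-phase₂))

-- Normal forms of B-terms

nfTree : BTerm → Tree
nfTree 𝐁        = node leaf (node leaf leaf)
nfTree (X' ∙ X) = compose (nfTree X') (nfTree X)

nfTree-LastArgApp : ∀ X → LastArgApp (nfTree X)
nfTree-LastArgApp 𝐁        = leaf , leaf , leaf , refl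
nfTree-LastArgApp (X' ∙ X) = compose-LastArgApp (nfTree X') (nfTree X) (nfTree-LastArgApp X') (nfTree-LastArgApp X)

embed-normal : ∀ {n} (e : Ap (Fin n)) → Normal (embed e)
embed-normal (v y ⊛ g)       (ξr st) = embed-normal g st
embed-normal ((a ⊛ b) ⊛ g)   (ξl st) = embed-normal (a ⊛ b) st
embed-normal ((a ⊛ b) ⊛ g)   (ξr st) = embed-normal g st

-- The last argument being an application is what rules out an η-redex under the innermost λ.
ƛ-embed-normal : ∀ {n} (e f g : Ap (Fin (suc n))) → Normal (ƛ (embed (e ⊛ (f ⊛ g))))
ƛ-embed-normal e f g (ξƛ st) = embed-normal (e ⊛ (f ⊛ g)) st

lams-normal : ∀ n (t : Term (suc n)) → Normal (ƛ t) → Normal (lams n (ƛ t))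
lams-normal zero    t nt = nt
lams-normal (suc n) t nt = lams-normal n (ƛ t) λ { (ξƛ st) → nt st }

nfBody-normal : ∀ T → LastArgApp T → Normal (lams (leaves T) (embed (nfBody T)))
nfBody-normal _ (f , a , b , refl) = lams-normal (inner (node f (node a b))) _ (ƛ-embed-normal _ _ _)

headVar-mapAp : ∀ {V W : Set} (h : V → W) e → headVar (mapAp h e) ≡ h (headVar e)
headVar-mapAp h (v y)   = refl
headVar-mapAp h (f ⊛ g) = headVar-mapAp h f

args-mapAp : ∀ {V W : Set} (h : V → W) e → args (mapAp h e) ≡ map (mapAp h) (args e)
args-mapAp h (v y)   = refl
args-mapAp h (f ⊛ g) = trans (cong (_++ [ mapAp h g ]) (args-mapAp h f)) (sym (map-++ (mapAp h) (args f) [ g ]))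

args-mapAp-label : ∀ {W : Set} (h : ℕ → W) T o → args (mapAp h (label T o)) ≡ map (mapAp h) (labels (treeArgs T) (suc o))
args-mapAp-label h T o = trans (args-mapAp h (label T o)) (cong (map (mapAp h)) (args-label T o))

vars-mapAp-All : ∀ {W : Set} {P : ℕ → Set} {Q : W → Set} (h : ℕ → W) → (∀ j → P j → Q (h j)) →
  ∀ e → AllVars P e → All Q (vars (mapAp h e))
vars-mapAp-All h H (v j)   p       = H j p ∷ []
vars-mapAp-All h H (a ⊛ b) (p , q) = ++⁺ (vars-mapAp-All h H a p) (vars-mapAp-All h H b q)

nfBody-isNF : ∀ {t} T → LastArgApp T → t ≈βη lams (leaves T) (embed (nfBody T)) → IsNF t (leaves T) (nfBody T)
nfBody-isNF T last conv = record
  { conv     = conv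
  ; normal   = nfBody-normal T last
  ; headX₁   = trans (cong toℕ (headVar-mapAp (clamp (inner T)) (label T 0)))
                     (cong (λ z → toℕ (clamp (inner T) z)) (headVar-label T 0))
  ; argsNoX₁ = subst (All (λ g → All (λ y → toℕ y ≢ 0) (vars g))) (sym (args-mapAp-label (clamp (inner T)) T 0))
                 (map⁺ (All.map (λ {e} → vars-mapAp-All (clamp (inner T)) clamp≢0 e) (labels-InRange (treeArgs T) 1)))
  }
  where
  clamp≢0 : ∀ j → InRange 1 (1 + sumLeaves (treeArgs T)) j → toℕ (clamp (inner T) j) ≢ 0
  clamp≢0 j (lo , hi) eq =
    <⇒≱ lo (≤-reflexive (trans (sym (toℕ-clamp (inner T) j (≤-pred (subst (j <_) (cong suc (sym (inner≡sumLeaves-treeArgs T))) hi)))) eq))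

nfTree-isNF : ∀ X → IsNF ⟦ X ⟧ (leaves (nfTree X)) (nfBody (nfTree X))
nfTree-isNF 𝐁        = nfBody-isNF (nfTree 𝐁) (nfTree-LastArgApp 𝐁) ε
nfTree-isNF (X' ∙ X) = nfBody-isNF (nfTree (X' ∙ X)) (nfTree-LastArgApp (X' ∙ X))
  (EqClosure.gmap (_· ⟦ X ⟧) ξl (IsNF.conv (nfTree-isNF X')) ◅◅
   EqClosure.gmap (_ ·_) ξr (IsNF.conv (nfTree-isNF X)) ◅◅
   Application.compose-≈βη (nfTree X') (nfTree X))

leadingLambdas : ∀ {k} → Term k → ℕ
leadingLambdas (ƛ t)   = suc (leadingLambdas t)
leadingLambdas (var _) = 0
leadingLambdas (_ · _) = 0

leadingLambdas-lams-embed : ∀ n (e : Ap (Fin n)) → leadingLambdas (lams n (embed e)) ≡ n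
leadingLambdas-lams-embed n e = trans (go n (embed e)) (trans (cong (n +_) (embed-no-λ e)) (+-identityʳ n))
  where
  go : ∀ n (t : Term n) → leadingLambdas (lams n t) ≡ n + leadingLambdas t
  go zero    t = refl
  go (suc n) t = trans (go n (ƛ t)) (+-suc n (leadingLambdas t))
  embed-no-λ : ∀ {n} (e : Ap (Fin n)) → leadingLambdas (embed e) ≡ 0
  embed-no-λ (v y)   = refl
  embed-no-λ (f ⊛ g) = refl

lams-injective : ∀ n {t s : Term n} → lams n t ≡ lams n s → t ≡ s
lams-injective zero    eq = eq
lams-injective (suc n) {t} eq = cong (λ { (ƛ z) → z ; _ → t }) (lams-injective n eq)

embed-injective : ∀ {n} (e e₀ : Ap (Fin n)) → embed e ≡ embed e₀ → e ≡ e₀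
embed-injective (v y) (v y₀) eq =
  cong v (trans (sym (opposite-involutive y)) (trans (cong (λ { (var z) → opposite z ; _ → y }) eq) (opposite-involutive y₀)))
embed-injective (f ⊛ g) (f₀ ⊛ g₀) eq =
  cong₂ _⊛_ (embed-injective f f₀ (cong (λ { (z · _) → z ; _ → embed f }) eq))
            (embed-injective g g₀ (cong (λ { (_ · z) → z ; _ → embed g }) eq))

lams-embed-injective : ∀ {n m} (e : Ap (Fin n)) (e₀ : Ap (Fin m)) → lams n (embed e) ≡ lams m (embed e₀) →
  Σ (n ≡ m) λ eq → subst (λ k → Ap (Fin k)) eq e ≡ e₀
lams-embed-injective {n} {m} e e₀ eq
  with trans (sym (leadingLambdas-lams-embed n e)) (trans (cong leadingLambdas eq) (leadingLambdas-lams-embed m e₀))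
... | refl = refl , embed-injective e e₀ (lams-injective n eq)

IsNF-unique : ∀ {t n m} (e : Ap (Fin n)) (e₀ : Ap (Fin m)) → IsNF t n e → IsNF t m e₀ →
  Σ (n ≡ m) λ eq → subst (λ k → Ap (Fin k)) eq e ≡ e₀
IsNF-unique e e₀ nf nf₀ = lams-embed-injective e e₀
  (normal-form-unique (IsNF.normal nf) (IsNF.normal nf₀) (EqClosure.symmetric _ (IsNF.conv nf) ◅◅ IsNF.conv nf₀))

-- Reading off l, a and N₁

a-mapAp-label : ∀ {W : Set} (h : ℕ → W) T o → a (mapAp h (label T o)) ≡ length (treeArgs T)
a-mapAp-label h T o = begin
  length (args (mapAp h (label T o)))                    ≡⟨ cong length (args-mapAp-label h T o) ⟩
  length (map (mapAp h) (labels (treeArgs T) (suc o)))   ≡⟨ length-map (mapAp h) (labels (treeArgs T) (suc o)) ⟩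
  length (labels (treeArgs T) (suc o))                   ≡⟨ length-labels (treeArgs T) (suc o) ⟩
  length (treeArgs T)                                    ∎
  where open ≡-Reasoning

a-nfBody : ∀ T → a (nfBody T) ≡ length (treeArgs T)
a-nfBody T = a-mapAp-label (clamp (inner T)) T 0

N₁-nfBody : ∀ T S Ss → treeArgs T ≡ S ∷ Ss → N₁ (nfBody T) ≡ just (mapAp (clamp (inner T)) (label S 1))
N₁-nfBody T S Ss eq = trans (cong (nth 0) (args-mapAp-label (clamp (inner T)) T 0))
                            (cong (λ z → nth 0 (map (mapAp (clamp (inner T))) (labels z 1))) eq)

shape-mapAp : ∀ {V W : Set} (h : V → W) e → shape (mapAp h e) ≡ shape e
shape-mapAp h (v y)   = refl
shape-mapAp h (f ⊛ g) = cong₂ node (shape-mapAp h f) (shape-mapAp h g)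

shape-mapAp-label : ∀ {W : Set} (h : ℕ → W) T o → shape (mapAp h (label T o)) ≡ T
shape-mapAp-label h T o = trans (shape-mapAp h (label T o)) (shape-label T o)

map-shape-nth-labels : ∀ {W : Set} (h : ℕ → W) i Ss c → Maybe.map shape (nth i (map (mapAp h) (labels Ss c))) ≡ nth i Ss
map-shape-nth-labels h i       []       c = refl
map-shape-nth-labels h zero    (S ∷ Ss) c = cong just (shape-mapAp-label h S c)
map-shape-nth-labels h (suc i) (S ∷ Ss) c = map-shape-nth-labels h i Ss _

map-shape-N₁-label : ∀ {W : Set} (h : ℕ → W) T o → Maybe.map shape (N₁ (mapAp h (label T o))) ≡ nth 0 (treeArgs T)
map-shape-N₁-label h T o =
  trans (cong (λ z → Maybe.map shape (nth 0 z)) (args-mapAp-label h T o)) (map-shape-nth-labels h 0 (treeArgs T) (suc o))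

graft-treeArgs-∷ : ∀ T' T S₁ Ss₁ → treeArgs T' ≡ S₁ ∷ Ss₁ →
  graft T (treeArgs T') ≡ (spine S₁ (proj₁ (graftAll (treeArgs T) Ss₁)) , proj₂ (graftAll (treeArgs T) Ss₁))
graft-treeArgs-∷ T' T S₁ Ss₁ eq = begin
  graft T (treeArgs T')                         ≡⟨ cong (graft T) eq ⟩
  graft T (S₁ ∷ Ss₁)                            ≡⟨ cong (λ z → graft z (S₁ ∷ Ss₁)) (spine-treeArgs T) ⟨
  graft (spine leaf (treeArgs T)) (S₁ ∷ Ss₁)    ≡⟨ graft-spine leaf (treeArgs T) (S₁ ∷ Ss₁) ⟩
  _                                             ∎
  where open ≡-Reasoning

treeArgs-compose : ∀ T' T S₁ Ss₁ → treeArgs T' ≡ S₁ ∷ Ss₁ →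
  treeArgs (compose T' T) ≡ (treeArgs S₁ ++ proj₁ (graftAll (treeArgs T) Ss₁)) ++ proj₂ (graftAll (treeArgs T) Ss₁)
treeArgs-compose T' T S₁ Ss₁ eq = begin
  treeArgs (compose T' T)                                ≡⟨ cong (λ P → treeArgs (spine (proj₁ P) (proj₂ P))) (graft-treeArgs-∷ T' T S₁ Ss₁ eq) ⟩
  treeArgs (spine (spine S₁ (proj₁ gs)) (proj₂ gs))      ≡⟨ treeArgs-spine (spine S₁ (proj₁ gs)) (proj₂ gs) ⟩
  treeArgs (spine S₁ (proj₁ gs)) ++ proj₂ gs             ≡⟨ cong (_++ proj₂ gs) (treeArgs-spine S₁ (proj₁ gs)) ⟩
  (treeArgs S₁ ++ proj₁ gs) ++ proj₂ gs                  ∎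
  where
  open ≡-Reasoning
  gs : List Tree × List Tree
  gs = graftAll (treeArgs T) Ss₁

leaves-compose-nfBody : ∀ T' T → leaves (compose T' T) ≡ leaves T' ∸ 1 + (leaves T ∸ a (nfBody T'))
leaves-compose-nfBody T' T = trans (leaves-compose T' T)
  (cong₂ (λ x y → x + (leaves T ∸ y)) (sym (inner≡sumLeaves-treeArgs T')) (sym (a-nfBody T')))

a-compose : ∀ T' T → LastArgApp T' →
  a (nfBody (compose T' T)) ≡ a (nfBody T) + aN₁ (nfBody T') + (a (nfBody T') ∸ leaves T)
a-compose T' T last' with LastArgApp⇒treeArgs-∷ T' last'
... | S₁ , Ss₁ , eq = begin
  a (nfBody (compose T' T))                                  ≡⟨ a-nfBody (compose T' T) ⟩
  length (treeArgs (compose T' T))                           ≡⟨ cong length (treeArgs-compose T' T S₁ Ss₁ eq) ⟩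
  length ((treeArgs S₁ ++ proj₁ gs) ++ proj₂ gs)             ≡⟨ length-++ (treeArgs S₁ ++ proj₁ gs) ⟩
  length (treeArgs S₁ ++ proj₁ gs) + length (proj₂ gs)       ≡⟨ cong₂ _+_ (length-++ (treeArgs S₁)) length-rest ⟩
  length (treeArgs S₁) + length (proj₁ gs) + (a (nfBody T') ∸ leaves T)
    ≡⟨ cong (λ z → z + (a (nfBody T') ∸ leaves T))
            (trans (+-comm (length (treeArgs S₁)) _) (cong₂ _+_ length-grafted (sym aN₁-nfBody))) ⟩
  a (nfBody T) + aN₁ (nfBody T') + (a (nfBody T') ∸ leaves T) ∎
  where
  open ≡-Reasoning
  gs : List Tree × List Tree
  gs = graftAll (treeArgs T) Ss₁
  length-rest : length (proj₂ gs) ≡ a (nfBody T') ∸ leaves T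
  length-rest = trans (cong (λ P → length (proj₂ P)) (sym (graft-treeArgs-∷ T' T S₁ Ss₁ eq)))
                      (trans (length-graft-rest T (treeArgs T')) (cong (_∸ leaves T) (sym (a-nfBody T'))))
  length-grafted : length (proj₁ gs) ≡ a (nfBody T)
  length-grafted = trans (length-graftAll (treeArgs T) Ss₁) (sym (a-nfBody T))
  aN₁-nfBody : aN₁ (nfBody T') ≡ length (treeArgs S₁)
  aN₁-nfBody = trans (cong (maybe a 0) (N₁-nfBody T' S₁ Ss₁ eq)) (a-mapAp-label (clamp (inner T')) S₁ 1)

σX-< : ∀ {n n'} m (e' : Ap (Fin n')) (j : Fin n) → 1 ≤ toℕ j → toℕ j < m →
  σX m e' j ≡ maybe′ (mapAp inj₂) (v (inj₁ j)) (nth (toℕ j) (args e'))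
σX-< m e' j 1≤j j<m with 1 ≤ᵇ toℕ j in eq₁ | toℕ j <ᵇ m in eq₂
... | true  | true  = refl
... | false | _     = ⊥-elim (subst True eq₁ (≤⇒≤ᵇ 1≤j))
... | true  | false = ⊥-elim (subst True eq₂ (<⇒<ᵇ j<m))

σX-≥ : ∀ {n n'} m (e' : Ap (Fin n')) (j : Fin n) → m ≤ toℕ j → σX m e' j ≡ v (inj₁ j)
σX-≥ m e' j m≤j with 1 ≤ᵇ toℕ j | toℕ j <ᵇ m in eq
... | false | _     = refl
... | true  | false = refl
... | true  | true  = ⊥-elim (<⇒≱ (<ᵇ⇒< (toℕ j) m (subst True (sym eq) _)) m≤j)

N₁-claim-app : ∀ {p n n'} (q : Ap (Fin p)) (e : Ap (Fin n)) (e' : Ap (Fin n')) f g → N₁ e' ≡ just (f ⊛ g) →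
  Maybe.map shape (N₁ q) ≡ Maybe.map shape (N₁ (f ⊛ g)) → N₁-claim q e e'
N₁-claim-app q e e' f g eq claim rewrite eq = claim

N₁-claim-var : ∀ {p n n'} (q : Ap (Fin p)) (e : Ap (Fin n)) (e' : Ap (Fin n')) y e₁ → N₁ e' ≡ just (v y) → N₁ e ≡ just e₁ →
  Maybe.map shape (N₁ q) ≡ just (shape (substAp (σX (n ⊓ a e') e') e₁)) → N₁-claim q e e'
N₁-claim-var q e e' y e₁ eq' eq claim rewrite eq' | eq = claim

map-shape-N₁-compose-app : ∀ T' T x y Ss₁ → treeArgs T' ≡ node x y ∷ Ss₁ →
  Maybe.map shape (N₁ (nfBody (compose T' T))) ≡ Maybe.map shape (N₁ (mapAp (clamp (inner T')) (label (node x y) 1)))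
map-shape-N₁-compose-app T' T x y Ss₁ eq = begin
  Maybe.map shape (N₁ (nfBody (compose T' T)))     ≡⟨ map-shape-N₁-label (clamp (inner (compose T' T))) (compose T' T) 0 ⟩
  nth 0 (treeArgs (compose T' T))                  ≡⟨ cong (nth 0) (treeArgs-compose T' T (node x y) Ss₁ eq) ⟩
  nth 0 (((treeArgs x ++ [ y ]) ++ _) ++ _)        ≡⟨ nth-zero-++ (treeArgs x) ⟩
  nth 0 (treeArgs (node x y))                      ≡⟨ map-shape-N₁-label (clamp (inner T')) (node x y) 1 ⟨
  Maybe.map shape (N₁ (mapAp (clamp (inner T')) (label (node x y) 1))) ∎
  where
  open ≡-Reasoning
  nth-zero-++ : ∀ {A : Set} (xs : List A) {y ys zs} → nth 0 (((xs ++ [ y ]) ++ ys) ++ zs) ≡ nth 0 (xs ++ [ y ])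
  nth-zero-++ []      = refl
  nth-zero-++ (_ ∷ _) = refl

substAp-mapAp : ∀ {U V W : Set} {τ : V → Ap W} {c : U → V} e → substAp τ (mapAp c e) ≡ substAp (λ j → τ (c j)) e
substAp-mapAp (v y)   = refl
substAp-mapAp (f ⊛ g) = cong₂ _⊛_ (substAp-mapAp f) (substAp-mapAp g)

shape-substAp-cong : ∀ {W : Set} {P : ℕ → Set} {τ : ℕ → Ap W} {τ' : ℕ → Ap ℕ} e → AllVars P e →
  (∀ j → P j → shape (τ j) ≡ shape (τ' j)) → shape (substAp τ e) ≡ shape (substAp τ' e)
shape-substAp-cong (v j)   p       h = h j p
shape-substAp-cong (f ⊛ g) (p , q) h = cong₂ node (shape-substAp-cong f p h) (shape-substAp-cong g q h)

shape-nth-labels : ∀ {W W' : Set} (g : W → W') (h : ℕ → W) (d : Ap W') (d₀ : Ap ℕ) i Ss c c' → i < length Ss →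
  shape (maybe′ (mapAp g) d (nth i (map (mapAp h) (labels Ss c)))) ≡ shape (nthOr d₀ i (labels Ss c'))
shape-nth-labels g h d d₀ zero    (S ∷ Ss) c c' _ =
  trans (shape-mapAp g _) (trans (shape-mapAp-label h S c) (sym (shape-label S c')))
shape-nth-labels g h d d₀ (suc i) (S ∷ Ss) c c' (s≤s lt) = shape-nth-labels g h d d₀ i Ss _ _ lt

-- When N₁(X') is a variable, the first argument of X'X is that of X with its variables x₂, x₃, …
-- replaced by the further arguments of X', i.e. A₁ grafted with them.
shape-σX-label : ∀ T' T Ss₁ A₁ → treeArgs T' ≡ leaf ∷ Ss₁ → leaves A₁ ≤ inner T →
  shape (substAp (σX (leaves T ⊓ a (nfBody T')) (nfBody T')) (mapAp (clamp (inner T)) (label A₁ 1))) ≡ proj₁ (graft A₁ Ss₁)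
shape-σX-label T' T Ss₁ A₁ eq A₁≤ = begin
  shape (substAp σ (mapAp (clamp (inner T)) (label A₁ 1)))   ≡⟨ cong shape (substAp-mapAp (label A₁ 1)) ⟩
  shape (substAp (λ j → σ (clamp (inner T) j)) (label A₁ 1)) ≡⟨ shape-substAp-cong (label A₁ 1) (label-InRange A₁ 1) same-shape ⟩
  shape (substAp ρ (label A₁ 1))                             ≡⟨ cong shape (proj₁ (substAp-label-graft A₁ ρ 1 Ss₁ 0 env)) ⟩
  shape (label (proj₁ (graft A₁ Ss₁)) 0)                     ≡⟨ shape-label _ 0 ⟩
  proj₁ (graft A₁ Ss₁)                                       ∎
  where
  open ≡-Reasoning
  m : ℕ
  m = leaves T ⊓ a (nfBody T')
  σ : Fin (leaves T) → Ap (Fin (leaves T) ⊎ Fin (leaves T'))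
  σ = σX m (nfBody T')
  ρ : ℕ → Ap ℕ
  ρ zero    = v 0
  ρ (suc i) = nthOr (v (0 + sumLeaves Ss₁ + (i ∸ length Ss₁))) i (labels Ss₁ 0)
  env : GraftEnv ρ 1 Ss₁ 0
  env = graftEnv-nthOr Ss₁ ρ 1 0 (λ i → refl)
  a-nfBody' : a (nfBody T') ≡ suc (length Ss₁)
  a-nfBody' = trans (a-nfBody T') (cong length eq)

  j' : ℕ → Fin (leaves T)
  j' i = clamp (inner T) (suc i)

  toℕ-j' : ∀ i → suc i ≤ leaves A₁ → toℕ (j' i) ≡ suc i
  toℕ-j' i hi = toℕ-clamp (inner T) (suc i) (≤-trans hi A₁≤)

  same-shape : ∀ j → InRange 1 (1 + leaves A₁) j → shape (σ (clamp (inner T) j)) ≡ shape (ρ j)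
  same-shape (suc i) (_ , s≤s hi) with suc i <? m
  ... | yes i<m = begin
    shape (σ (j' i))
      ≡⟨ cong shape (σX-< m (nfBody T') (j' i) (subst (1 ≤_) (sym (toℕ-j' i hi)) (s≤s z≤n)) (subst (_< m) (sym (toℕ-j' i hi)) i<m)) ⟩
    shape (maybe′ (mapAp inj₂) (v (inj₁ (j' i))) (nth (toℕ (j' i)) (args (nfBody T'))))
      ≡⟨ cong₂ (λ k es → shape (maybe′ (mapAp inj₂) (v (inj₁ (j' i))) (nth k es))) (toℕ-j' i hi) args-nfBody' ⟩
    shape (maybe′ (mapAp inj₂) (v (inj₁ (j' i))) (nth i (map (mapAp (clamp (inner T'))) (labels Ss₁ 2))))
      ≡⟨ shape-nth-labels inj₂ (clamp (inner T')) (v (inj₁ (j' i))) (v (0 + sumLeaves Ss₁ + (i ∸ length Ss₁)))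
                          i Ss₁ 2 0 i<length ⟩
    shape (ρ (suc i))                                                   ∎
    where
    args-nfBody' : args (nfBody T') ≡ map (mapAp (clamp (inner T'))) (labels (leaf ∷ Ss₁) 1)
    args-nfBody' = trans (args-mapAp-label (clamp (inner T')) T' 0) (cong (λ z → map (mapAp (clamp (inner T'))) (labels z 1)) eq)
    i<length : i < length Ss₁
    i<length = ≤-pred (subst (suc (suc i) ≤_) a-nfBody' (≤-trans i<m (m⊓n≤n (leaves T) (a (nfBody T')))))
  ... | no i≮m = begin
    shape (σ (j' i))     ≡⟨ cong shape (σX-≥ m (nfBody T') (j' i) (subst (m ≤_) (sym (toℕ-j' i hi)) (≮⇒≥ i≮m))) ⟩
    leaf                 ≡⟨ cong shape (nthOr-beyond _ i (labels Ss₁ 0) (subst (_≤ i) (sym (length-labels Ss₁ 0)) length≤i)) ⟨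
    shape (ρ (suc i))    ∎
    where
    length≤i : length Ss₁ ≤ i
    length≤i = ≮⇒≥ λ i<length → i≮m (⊓-glb (s≤s (≤-trans hi A₁≤)) (subst (suc (suc i) ≤_) (sym a-nfBody') (s≤s i<length)))

map-shape-N₁-compose-var : ∀ T' T Ss₁ A₁ As → treeArgs T' ≡ leaf ∷ Ss₁ → treeArgs T ≡ A₁ ∷ As →
  Maybe.map shape (N₁ (nfBody (compose T' T))) ≡ just (proj₁ (graft A₁ Ss₁))
map-shape-N₁-compose-var T' T Ss₁ A₁ As eq eqA = begin
  Maybe.map shape (N₁ (nfBody (compose T' T)))   ≡⟨ map-shape-N₁-label (clamp (inner (compose T' T))) (compose T' T) 0 ⟩
  nth 0 (treeArgs (compose T' T))                ≡⟨ cong (nth 0) (treeArgs-compose T' T leaf Ss₁ eq) ⟩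
  nth 0 (proj₁ (graftAll (treeArgs T) Ss₁) ++ proj₂ (graftAll (treeArgs T) Ss₁))
    ≡⟨ cong (λ z → nth 0 (proj₁ (graftAll z Ss₁) ++ proj₂ (graftAll z Ss₁))) eqA ⟩
  just (proj₁ (graft A₁ Ss₁))                    ∎
  where open ≡-Reasoning

N₁-claim-compose : ∀ T' T → LastArgApp T' → LastArgApp T → N₁-claim (nfBody (compose T' T)) (nfBody T) (nfBody T')
N₁-claim-compose T' T last' last with LastArgApp⇒treeArgs-∷ T' last'
... | node x y , Ss₁ , eq =
  N₁-claim-app (nfBody (compose T' T)) (nfBody T) (nfBody T') _ _
    (N₁-nfBody T' (node x y) Ss₁ eq) (map-shape-N₁-compose-app T' T x y Ss₁ eq)
... | leaf , Ss₁ , eq with LastArgApp⇒treeArgs-∷ T last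
...   | A₁ , As , eqA =
  N₁-claim-var (nfBody (compose T' T)) (nfBody T) (nfBody T') _ _
    (N₁-nfBody T' leaf Ss₁ eq) (N₁-nfBody T A₁ As eqA)
    (trans (map-shape-N₁-compose-var T' T Ss₁ A₁ As eq eqA) (cong just (sym (shape-σX-label T' T Ss₁ A₁ eq A₁≤))))
  where
  A₁≤ : leaves A₁ ≤ inner T
  A₁≤ = subst (leaves A₁ ≤_) (sym (trans (inner≡sumLeaves-treeArgs T) (cong sumLeaves eqA))) (m≤m+n (leaves A₁) (sumLeaves As))

lemma3p7 : (X X' : BTerm) {n n' : ℕ} (e : Ap (Fin n)) (e' : Ap (Fin n')) →
    IsNF ⟦ X ⟧ n e → IsNF ⟦ X' ⟧ n' e' →
    Σ ℕ (λ p → Σ (Ap (Fin p)) (λ q →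
      IsNF ⟦ X' ∙ X ⟧ p q
      × p ≡ n' ∸ 1 + (n ∸ a e')
      × a q ≡ a e + aN₁ e' + (a e' ∸ n)
      × N₁-claim q e e'))
lemma3p7 X X' e e' nf nf'
  with IsNF-unique e _ nf (nfTree-isNF X) | IsNF-unique e' _ nf' (nfTree-isNF X')
... | refl , refl | refl , refl =
  leaves (nfTree (X' ∙ X)) , nfBody (nfTree (X' ∙ X)) , nfTree-isNF (X' ∙ X) ,
  leaves-compose-nfBody (nfTree X') (nfTree X) ,
  a-compose (nfTree X') (nfTree X) (nfTree-LastArgApp X') ,
  N₁-claim-compose (nfTree X') (nfTree X) (nfTree-LastArgApp X') (nfTree-LastArgApp X)
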